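{- For integers $m\ge 1$ and $n\ge 0$ let $D_n(m)=\sum_{k=0}^{n}\binom{n-k}{k}^m$. Then for every fixed $m$, $$\lim_{n\to\infty}\frac{D_{n+1}(m)}{D_n(m)}=\frac{F_m\sqrt5+L_m}{2},$$ where $F_m$ are the Fibonacci numbers ($F_0=0$, $F_1=1$, $F_{k}=F_{k-1}+F_{k-2}$) and $L_m$ are the Lucas numbers ($L_0=2$, $L_1=1$, $L_k=L_{k-1}+L_{k-2}$).
   Context: Binomial coefficients $\binom{a}{b}$ with $b>a$ are zero. The number $D_n(m)$ counts $m$-tuples of compositions of $n$ with parts in $\{1,2\}$ all having the same number of parts. -}

module Defs where

open import Data.Nat using (ℕ; zero; suc; _+_; _∸_; _^_; _≤_; NonZero; >-nonZero)
open import Data.Nat.Properties using (^-zeroˡ; m≤m+n)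
open import Data.Nat.Combinatorics using (_C_)
open import Data.List using (List; map; upTo)
open import Data.Nat.ListAction using (sum)
open import Data.Integer using (ℤ; +_)
open import Data.Rational using (ℚ; _/_; _<_; _-_; _*_; 0ℚ)
open import Data.Sum using (_⊎_)
open import Data.Product using (_×_)
open import Relation.Binary.PropositionalEquality using (subst; sym)

-- D n m = Σ_{k=0}^{n} C(n-k, k)^m   (C a b = 0 for b > a, as in stdlib's _C_)
D : ℕ → ℕ → ℕ
D n m = sum (map (λ k → ((n ∸ k) C k) ^ m) (upTo (suc n)))

-- the k = 0 term equals 1, so D n m ≥ 1
D-pos : ∀ n m → 1 ≤ D n m
D-pos n m = subst (_≤ D n m) (^-zeroˡ m) (m≤m+n (1 ^ m) _)

D-nonZero : ∀ n m → NonZero (D n m)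
D-nonZero n m = >-nonZero (D-pos n m)

ratio : ℕ → ℕ → ℚ
ratio m n = _/_ (+ D (suc n) m) (D n m) {{D-nonZero n m}}

fib : ℕ → ℕ
fib zero = 0
fib (suc zero) = 1
fib (suc (suc k)) = fib (suc k) + fib k

lucas : ℕ → ℕ
lucas zero = 2
lucas (suc zero) = 1
lucas (suc (suc k)) = lucas (suc k) + lucas k

ℕ→ℚ : ℕ → ℚ
ℕ→ℚ k = (+ k) / 1

-- The real number φₘ = (F_m √5 + L_m)/2 is represented by its Dedekind cut.
-- q < φₘ  ⇔  2q − L_m < F_m √5  ⇔  (2q − L_m < 0) ∨ (2q − L_m)² < 5 F_m²
BelowTarget : ℕ → ℚ → Set
BelowTarget m q =
  let t = (ℕ→ℚ 2 * q) - ℕ→ℚ (lucas m) in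
  (t < 0ℚ) ⊎ (t * t < ℕ→ℚ 5 * (ℕ→ℚ (fib m) * ℕ→ℚ (fib m)))

-- φₘ < q  ⇔  F_m √5 < 2q − L_m  ⇔  (0 < 2q − L_m) ∧ 5 F_m² < (2q − L_m)²
AboveTarget : ℕ → ℚ → Set
AboveTarget m q =
  let t = (ℕ→ℚ 2 * q) - ℕ→ℚ (lucas m) in
  (0ℚ < t) × (ℕ→ℚ 5 * (ℕ→ℚ (fib m) * ℕ→ℚ (fib m)) < t * t)

module Submission where

-- With term n k = C(n−k, k), two exact identities drive the proof: in n,
-- term (n+1) k / term n k = (n+1−k)/(n+1−2k); in k, for n = 2k+1+w,
-- term n (k+1) / term n k = (w+1)w / ((k+1)(k+1+w)).  Fix an approximant
-- P/Q = (Q+e)/Q of φ with e(Q+e) = Q² ∓ 1 and split D_n at k ≈ e(n+1)/(Q+2e):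
-- on one side every term grows with n by at least (resp. at most) (P/Q)^m, on
-- the other the terms are geometric in k and hence negligible (LowerBound,
-- UpperBound).  So A/B < (P/Q)^m forces A·D_n < B·D_{n+1} eventually, and
-- dually.  Fibonacci approximants make (P/Q)^m as close to φ^m as needed
-- (lower-from-cut, upper-from-cut); the last section reads the ℚ cuts as these
-- integer conditions.

open import Defs
open import Data.Nat
open import Data.Nat.Properties
open import Data.Nat.Combinatorics using (_C_; nCk+nC[k+1]≡[n+1]C[k+1])
open import Data.Nat.DivMod using (_/_; m/n*n≤m; m≡m%n+[m/n]*n; m%n<n)
open import Data.Nat.ListAction using (sum)
open import Data.Nat.Tactic.RingSolver using (solve-∀)
open import Data.List using (map; applyUpTo)
open import Data.Product using (_×_; _,_; ∃-syntax; Σ; proj₁; proj₂)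
open import Data.Sum using (_⊎_; inj₁; inj₂)
open import Data.Empty using (⊥; ⊥-elim)
open import Relation.Nullary using (yes; no)
open import Relation.Binary.PropositionalEquality

Sum : (ℕ → ℕ) → ℕ → ℕ
Sum f zero = 0
Sum f (suc n) = f 0 + Sum (λ i → f (suc i)) n

sum-applyUpTo : ∀ (g h : ℕ → ℕ) n → sum (map g (applyUpTo h n)) ≡ Sum (λ i → g (h i)) n
sum-applyUpTo g h zero = refl
sum-applyUpTo g h (suc n) = cong (g (h 0) +_) (sum-applyUpTo g (λ i → h (suc i)) n)

Sum-cong : ∀ n {f g : ℕ → ℕ} → (∀ i → f i ≡ g i) → Sum f n ≡ Sum g n
Sum-cong zero e = refl
Sum-cong (suc n) e = cong₂ _+_ (e 0) (Sum-cong n (λ i → e (suc i)))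

Sum-mono : ∀ n (f g : ℕ → ℕ) → (∀ i → i < n → f i ≤ g i) → Sum f n ≤ Sum g n
Sum-mono zero f g le = z≤n
Sum-mono (suc n) f g le = +-mono-≤ (le 0 z<s) (Sum-mono n _ _ (λ i i<n → le (suc i) (s<s i<n)))

Sum-snoc : ∀ n (f : ℕ → ℕ) → Sum f (suc n) ≡ Sum f n + f n
Sum-snoc zero f = +-identityʳ (f 0)
Sum-snoc (suc n) f = trans (cong (f 0 +_) (Sum-snoc n (λ i → f (suc i)))) (sym (+-assoc (f 0) _ _))

Sum-split : ∀ a b (f : ℕ → ℕ) → Sum f (a + b) ≡ Sum f a + Sum (λ i → f (a + i)) b
Sum-split zero b f = refl
Sum-split (suc a) b f = trans (cong (f 0 +_) (Sum-split a b (λ i → f (suc i)))) (sym (+-assoc (f 0) _ _))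

Sum-scale : ∀ n x (f : ℕ → ℕ) → Sum (λ i → x * f i) n ≡ x * Sum f n
Sum-scale zero x f = sym (*-zeroʳ x)
Sum-scale (suc n) x f = trans (cong (x * f 0 +_) (Sum-scale n x (λ i → f (suc i)))) (sym (*-distribˡ-+ x (f 0) _))

Sum-term : ∀ n i (f : ℕ → ℕ) → i < n → f i ≤ Sum f n
Sum-term (suc n) zero f _ = m≤m+n (f 0) _
Sum-term (suc n) (suc i) f (s<s i<n) = ≤-trans (Sum-term n i (λ j → f (suc j)) i<n) (m≤n+m _ (f 0))

Sum-prefix : ∀ a b (f : ℕ → ℕ) → a ≤ b → Sum f a ≤ Sum f b
Sum-prefix a b f a≤b = begin
  Sum f a                                ≤⟨ m≤m+n (Sum f a) _ ⟩
  Sum f a + Sum (λ i → f (a + i)) (b ∸ a) ≡⟨ sym (Sum-split a (b ∸ a) f) ⟩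
  Sum f (a + (b ∸ a))                    ≡⟨ cong (Sum f) (m+[n∸m]≡n a≤b) ⟩
  Sum f b                                ∎
  where open ≤-Reasoning

-- Binomial coefficients by Pascal's rule; this recursion is what the
-- identities below are proved by.
binom : ℕ → ℕ → ℕ
binom n zero = 1
binom zero (suc k) = 0
binom (suc n) (suc k) = binom n k + binom n (suc k)

C≡binom : ∀ n k → n C k ≡ binom n k
C≡binom n zero = refl
C≡binom zero (suc k) = refl
C≡binom (suc n) (suc k) =
  trans (sym (nCk+nC[k+1]≡[n+1]C[k+1] n k)) (cong₂ _+_ (C≡binom n k) (C≡binom n (suc k)))

binom-over : ∀ {n k} → n < k → binom n k ≡ 0
binom-over {zero} {suc k} _ = refl
binom-over {suc n} {suc k} (s<s n<k) = cong₂ _+_ (binom-over n<k) (binom-over (m<n⇒m<1+n n<k))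

binom-1 : ∀ n → binom n 1 ≡ n
binom-1 zero = refl
binom-1 (suc n) = cong suc (binom-1 n)

binom-absorb : ∀ n k → binom n k * (n ∸ k) ≡ binom n (suc k) * suc k
binom-absorb zero k = trans (cong (binom 0 k *_) (0∸n≡0 k)) (*-zeroʳ (binom 0 k))
binom-absorb (suc n) zero =
  trans (*-identityˡ (suc n)) (trans (cong suc (sym (binom-1 n))) (sym (*-identityʳ _)))
binom-absorb (suc n) (suc k) with k <? n
... | yes k<n = begin
  (x + y) * (n ∸ k)               ≡⟨ cong ((x + y) *_) (+-∸-assoc 1 k<n) ⟩
  (x + y) * suc r                 ≡⟨ expand x y r ⟩
  x * suc r + y + y * r           ≡⟨ cong₂ (λ p q → p + y + q) absorb-k (binom-absorb n (suc k)) ⟩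
  y * suc k + y + z * suc (suc k) ≡⟨ collect y z k ⟩
  (y + z) * suc (suc k)           ∎
  where
  open ≡-Reasoning
  x y z r : ℕ
  x = binom n k
  y = binom n (suc k)
  z = binom n (suc (suc k))
  r = n ∸ suc k
  absorb-k : x * suc r ≡ y * suc k
  absorb-k = trans (cong (x *_) (sym (+-∸-assoc 1 k<n))) (binom-absorb n k)
  expand : ∀ x y r → (x + y) * suc r ≡ x * suc r + y + y * r
  expand = solve-∀
  collect : ∀ y z k → y * suc k + y + z * suc (suc k) ≡ (y + z) * suc (suc k)
  collect = solve-∀
... | no k≮n = begin
  (binom n k + binom n (suc k)) * (n ∸ k)           ≡⟨ cong ((binom n k + binom n (suc k)) *_) (m≤n⇒m∸n≡0 n≤k) ⟩
  (binom n k + binom n (suc k)) * 0                 ≡⟨ *-zeroʳ (binom n k + binom n (suc k)) ⟩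
  0                                                 ≡⟨ cong₂ (λ p q → (p + q) * suc (suc k)) vanish₁ vanish₂ ⟨
  (binom n (suc k) + binom n (suc (suc k))) * suc (suc k) ∎
  where
  open ≡-Reasoning
  n≤k : n ≤ k
  n≤k = ≮⇒≥ k≮n
  vanish₁ : binom n (suc k) ≡ 0
  vanish₁ = binom-over (s≤s n≤k)
  vanish₂ : binom n (suc (suc k)) ≡ 0
  vanish₂ = binom-over (m≤n⇒m≤1+n (s≤s n≤k))

binom-succ : ∀ n k → binom (suc n) (suc k) * suc k ≡ suc n * binom n k
binom-succ n k with k ≤? n
... | yes k≤n = begin
  (binom n k + binom n (suc k)) * suc k           ≡⟨ *-distribʳ-+ (suc k) (binom n k) _ ⟩
  binom n k * suc k + binom n (suc k) * suc k     ≡⟨ cong (binom n k * suc k +_) (binom-absorb n k) ⟨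
  binom n k * suc k + binom n k * (n ∸ k)         ≡⟨ *-distribˡ-+ (binom n k) (suc k) (n ∸ k) ⟨
  binom n k * (suc k + (n ∸ k))                   ≡⟨ cong (λ t → binom n k * suc t) (m+[n∸m]≡n k≤n) ⟩
  binom n k * suc n                               ≡⟨ *-comm (binom n k) (suc n) ⟩
  suc n * binom n k                               ∎
  where open ≡-Reasoning
... | no k≰n = begin
  (binom n k + binom n (suc k)) * suc k ≡⟨ cong₂ (λ p q → (p + q) * suc k) (binom-over n<k) (binom-over (m<n⇒m<1+n n<k)) ⟩
  0                                     ≡⟨ *-zeroʳ (suc n) ⟨
  suc n * 0                             ≡⟨ cong (suc n *_) (binom-over n<k) ⟨
  suc n * binom n k                     ∎
  where
  open ≡-Reasoning
  n<k : n < k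
  n<k = ≰⇒> k≰n

binom-absorb-top : ∀ k r → binom (k + r) (suc k) * suc k ≡ binom (k + r) k * r
binom-absorb-top k r =
  sym (trans (cong (binom (k + r) k *_) (sym (m+n∸m≡n k r))) (binom-absorb (k + r) k))

binom-shift : ∀ k j → binom (k + suc j) k * suc j ≡ (k + suc j) * binom (k + j) k
binom-shift k j = begin
  binom (k + suc j) k * suc j         ≡⟨ binom-absorb-top k (suc j) ⟨
  binom (k + suc j) (suc k) * suc k   ≡⟨ cong (λ t → binom t (suc k) * suc k) (+-suc k j) ⟩
  binom (suc (k + j)) (suc k) * suc k ≡⟨ binom-succ (k + j) k ⟩
  suc (k + j) * binom (k + j) k       ≡⟨ cong (_* binom (k + j) k) (+-suc k j) ⟨
  (k + suc j) * binom (k + j) k       ∎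
  where open ≡-Reasoning

term : ℕ → ℕ → ℕ
term n k = binom (n ∸ k) k

D≡Sum : ∀ n m → D n m ≡ Sum (λ k → term n k ^ m) (suc n)
D≡Sum n m = trans (sum-applyUpTo (λ k → ((n ∸ k) C k) ^ m) (λ i → i) (suc n))
  (Sum-cong (suc n) (λ k → cong (_^ m) (C≡binom (n ∸ k) k)))

term-vanishes : ∀ {n k} → n < k + k → term n k ≡ 0
term-vanishes {n} {k} n<2k with k ≤? n
... | yes k≤n = binom-over (subst (n ∸ k <_) (m+n∸m≡n k k) (∸-monoˡ-< n<2k k≤n))
... | no k≰n = binom-over (subst (_< k) (sym (m≤n⇒m∸n≡0 (<⇒≤ (≰⇒> k≰n)))) (≤-trans (s≤s z≤n) (≰⇒> k≰n)))

term-cases : ∀ n k → (∃[ j ] k + (k + j) ≡ n) ⊎ n < k + k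
term-cases n k with (k + k) ≤? n
... | yes 2k≤n = inj₁ (n ∸ (k + k) , trans (sym (+-assoc k k _)) (m+[n∸m]≡n 2k≤n))
... | no 2k≰n = inj₂ (≰⇒> 2k≰n)

term-n-step : ∀ k j → term (suc (k + (k + j))) k * suc j ≡ (k + suc j) * term (k + (k + j)) k
term-n-step k j = begin
  term (suc (k + (k + j))) k * suc j  ≡⟨ cong (λ t → binom t k * suc j) top₁ ⟩
  binom (k + suc j) k * suc j         ≡⟨ binom-shift k j ⟩
  (k + suc j) * binom (k + j) k       ≡⟨ cong (λ t → (k + suc j) * binom t k) (m+n∸m≡n k (k + j)) ⟨
  (k + suc j) * term (k + (k + j)) k  ∎
  where
  open ≡-Reasoning
  top₁ : suc (k + (k + j)) ∸ k ≡ k + suc j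
  top₁ = trans (cong (_∸ k) (sym (+-suc k (k + j)))) (trans (m+n∸m≡n k (suc (k + j))) (sym (+-suc k j)))

term-k-step : ∀ k w → let n = k + suc (k + w) in
  term n (suc k) * (suc k * (k + suc w)) ≡ term n k * (suc w * w)
term-k-step k w = begin
  term n (suc k) * (suc k * (k + suc w))     ≡⟨ cong (λ t → binom t (suc k) * (suc k * (k + suc w))) top₁ ⟩
  y * (suc k * (k + suc w))                  ≡⟨ *-assoc y (suc k) (k + suc w) ⟨
  y * suc k * (k + suc w)                    ≡⟨ cong (_* (k + suc w)) (binom-absorb-top k w) ⟩
  binom (k + w) k * w * (k + suc w)          ≡⟨ rearrange (binom (k + w) k) w (k + suc w) ⟩
  ((k + suc w) * binom (k + w) k) * w        ≡⟨ cong (_* w) (binom-shift k w) ⟨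
  x * suc w * w                              ≡⟨ *-assoc x (suc w) w ⟩
  x * (suc w * w)                            ≡⟨ cong (λ t → binom t k * (suc w * w)) top₀ ⟨
  term n k * (suc w * w)                     ∎
  where
  open ≡-Reasoning
  n x y : ℕ
  n = k + suc (k + w)
  x = binom (k + suc w) k
  y = binom (k + w) (suc k)
  top₀ : n ∸ k ≡ k + suc w
  top₀ = trans (m+n∸m≡n k (suc (k + w))) (sym (+-suc k w))
  top₁ : n ∸ suc k ≡ k + w
  top₁ = trans (cong (_∸ suc k) (+-suc k (k + w))) (m+n∸m≡n k (k + w))
  rearrange : ∀ x w z → x * w * z ≡ (z * x) * w
  rearrange = solve-∀

-- Comparing ratios by cross-multiplication: if y/x = w/z then
-- u/v ≤ w/z gives x·u ≤ y·v, and u/v ≤ z/w gives y·u ≤ x·v.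
cross-≤ : ∀ x y z w u v .{{_ : NonZero z}} → y * z ≡ x * w → z * u ≤ w * v → x * u ≤ y * v
cross-≤ x y z w u v eq h = *-cancelʳ-≤ (x * u) (y * v) z (begin
  x * u * z   ≡⟨ swap x u z ⟩
  x * (z * u) ≤⟨ *-monoʳ-≤ x h ⟩
  x * (w * v) ≡⟨ *-assoc x w v ⟨
  x * w * v   ≡⟨ cong (_* v) eq ⟨
  y * z * v   ≡⟨ swap y z v ⟩
  y * (v * z) ≡⟨ *-assoc y v z ⟨
  y * v * z   ∎)
  where
  open ≤-Reasoning
  swap : ∀ a b c → a * b * c ≡ a * (c * b)
  swap = solve-∀

cross-≥ : ∀ x y z w u v .{{_ : NonZero z}} → y * z ≡ x * w → w * u ≤ z * v → y * u ≤ x * v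
cross-≥ x y z w u v eq h = *-cancelʳ-≤ (y * u) (x * v) z (begin
  y * u * z   ≡⟨ swap y u z ⟩
  y * z * u   ≡⟨ cong (_* u) eq ⟩
  x * w * u   ≡⟨ *-assoc x w u ⟩
  x * (w * u) ≤⟨ *-monoʳ-≤ x h ⟩
  x * (z * v) ≡⟨ regroup x v z ⟨
  x * v * z   ∎)
  where
  open ≤-Reasoning
  swap : ∀ a b c → a * b * c ≡ a * c * b
  swap = solve-∀
  regroup : ∀ a b c → a * b * c ≡ a * (c * b)
  regroup = solve-∀

-- Both n-ratio bounds reduce to comparing e(j+1) with Qk, where n = 2k + j.
n-ratio-threshold : ∀ Q e k j → e * suc (k + (k + j)) ≡ e * suc j + 2 * e * k × (Q + 2 * e) * k ≡ Q * k + 2 * e * k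
n-ratio-threshold Q e k j = expand₁ e k j , expand₂ Q e k
  where
  expand₁ : ∀ e k j → e * suc (k + (k + j)) ≡ e * suc j + 2 * e * k
  expand₁ = solve-∀
  expand₂ : ∀ Q e k → (Q + 2 * e) * k ≡ Q * k + 2 * e * k
  expand₂ = solve-∀

-- Beyond the threshold k ≥ e(n+1)/(Q+2e) the terms grow with n at least
-- by the factor (Q+e)/Q:  term (n+1) k / term n k = (n+1−k)/(n+1−2k).
n-ratio-above : ∀ Q e n k → e * suc n ≤ (Q + 2 * e) * k → term n k * (Q + e) ≤ term (suc n) k * Q
n-ratio-above Q e n k h with term-cases n k
... | inj₂ n<2k = subst (λ t → t * (Q + e) ≤ term (suc n) k * Q) (sym (term-vanishes {n} {k} n<2k)) z≤n
... | inj₁ (j , refl) = cross-≤ (term n k) (term (suc n) k) (suc j) (k + suc j) (Q + e) Q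
        (trans (term-n-step k j) (*-comm (k + suc j) _)) (begin
  suc j * (Q + e)      ≡⟨ expand Q e j ⟩
  Q * suc j + e * suc j ≤⟨ +-monoʳ-≤ (Q * suc j) ej≤Qk ⟩
  Q * suc j + Q * k    ≡⟨ collect Q j k ⟩
  (k + suc j) * Q      ∎)
  where
  open ≤-Reasoning
  ej≤Qk : e * suc j ≤ Q * k
  ej≤Qk with n-ratio-threshold Q e k j
  ... | eq₁ , eq₂ = +-cancelʳ-≤ (2 * e * k) _ _ (subst₂ _≤_ eq₁ eq₂ h)
  expand : ∀ Q e j → suc j * (Q + e) ≡ Q * suc j + e * suc j
  expand = solve-∀
  collect : ∀ Q j k → Q * suc j + Q * k ≡ (k + suc j) * Q
  collect = solve-∀

n-ratio-below : ∀ Q e n k → 1 ≤ Q → (Q + 2 * e) * k ≤ e * suc n → term (suc n) k * Q ≤ term n k * (Q + e)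
n-ratio-below Q e n k Q≥1 h with term-cases n k
... | inj₁ (j , refl) = cross-≥ (term n k) (term (suc n) k) (suc j) (k + suc j) Q (Q + e)
        (trans (term-n-step k j) (*-comm (k + suc j) _)) (begin
  (k + suc j) * Q      ≡⟨ expand Q j k ⟩
  Q * k + Q * suc j    ≤⟨ +-monoˡ-≤ (Q * suc j) Qk≤ej ⟩
  e * suc j + Q * suc j ≡⟨ collect Q e j ⟩
  suc j * (Q + e)      ∎)
  where
  open ≤-Reasoning
  Qk≤ej : Q * k ≤ e * suc j
  Qk≤ej with n-ratio-threshold Q e k j
  ... | eq₁ , eq₂ = +-cancelʳ-≤ (2 * e * k) _ _ (subst₂ _≤_ eq₂ eq₁ h)
  expand : ∀ Q j k → (k + suc j) * Q ≡ Q * k + Q * suc j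
  expand = solve-∀
  collect : ∀ Q e j → e * suc j + Q * suc j ≡ suc j * (Q + e)
  collect = solve-∀
... | inj₂ n<2k = ⊥-elim (<⇒≱ (*-mono-≤ Q≥1 k≥1) Qk≤0)
  where
  -- n < 2k forces k ≥ 1, while the hypothesis then forces Qk ≤ 0.
  k≥1 : 1 ≤ k
  k≥1 = positive n<2k
    where
    positive : ∀ {k} → n < k + k → 1 ≤ k
    positive {zero} ()
    positive {suc _} _ = s≤s z≤n
  Qk≤0 : Q * k ≤ 0
  Qk≤0 = +-cancelʳ-≤ (2 * e * k) (Q * k) 0 (begin
    Q * k + 2 * e * k ≡⟨ expand Q e k ⟨
    (Q + 2 * e) * k   ≤⟨ h ⟩
    e * suc n         ≤⟨ *-monoʳ-≤ e n<2k ⟩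
    e * (k + k)       ≡⟨ double e k ⟩
    0 + 2 * e * k     ∎)
    where
    open ≤-Reasoning
    expand : ∀ Q e k → (Q + 2 * e) * k ≡ Q * k + 2 * e * k
    expand = solve-∀
    double : ∀ e k → e * (k + k) ≡ 0 + 2 * e * k
    double = solve-∀

k-step-denominator-nonZero : ∀ k w → NonZero (suc k * (k + suc w))
k-step-denominator-nonZero k w rewrite +-suc k w = m*n≢0 (suc k) (suc (k + w))

k-step-above : ∀ k w u v → suc k * (k + suc w) * u ≤ suc w * w * v →
  term (k + suc (k + w)) k * u ≤ term (k + suc (k + w)) (suc k) * v
k-step-above k w u v h = cross-≤ (term n k) (term n (suc k)) (suc k * (k + suc w)) (suc w * w) u v
  {{k-step-denominator-nonZero k w}} (term-k-step k w) h
  where n = k + suc (k + w)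

k-step-below : ∀ k w u v → suc w * w * u ≤ suc k * (k + suc w) * v →
  term (k + suc (k + w)) (suc k) * u ≤ term (k + suc (k + w)) k * v
k-step-below k w u v h = cross-≥ (term n k) (term n (suc k)) (suc k * (k + suc w)) (suc w * w) u v
  {{k-step-denominator-nonZero k w}} (term-k-step k w) h
  where n = k + suc (k + w)

^-distribʳ-* : ∀ x y m → (x * y) ^ m ≡ x ^ m * y ^ m
^-distribʳ-* x y zero = refl
^-distribʳ-* x y (suc m) = trans (cong (x * y *_) (^-distribʳ-* x y m)) (regroup x y (x ^ m) (y ^ m))
  where
  regroup : ∀ x y a b → x * y * (a * b) ≡ x * a * (y * b)
  regroup = solve-∀

pow-mono : ∀ m x u y v → x * u ≤ y * v → x ^ m * u ^ m ≤ y ^ m * v ^ m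
pow-mono m x u y v h = subst₂ _≤_ (^-distribʳ-* x u m) (^-distribʳ-* y v m) (^-monoˡ-≤ m h)

Sum-growing : ∀ K (f : ℕ → ℕ) U V → (∀ k → k < K → f k * U ≤ f (suc k) * V) →
  Sum f K * U ≤ Sum f K * V + f K * V
Sum-growing zero f U V h = z≤n
Sum-growing (suc K) f U V h = begin
  Sum f (suc K) * U                     ≡⟨ cong (_* U) (Sum-snoc K f) ⟩
  (Sum f K + f K) * U                   ≡⟨ *-distribʳ-+ U (Sum f K) (f K) ⟩
  Sum f K * U + f K * U                 ≤⟨ +-mono-≤ (Sum-growing K f U V (λ k k<K → h k (m<n⇒m<1+n k<K))) (h K (n<1+n K)) ⟩
  Sum f K * V + f K * V + f (suc K) * V ≡⟨ cong (_+ f (suc K) * V) (*-distribʳ-+ V (Sum f K) (f K)) ⟨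
  (Sum f K + f K) * V + f (suc K) * V   ≡⟨ cong (λ t → t * V + f (suc K) * V) (Sum-snoc K f) ⟨
  Sum f (suc K) * V + f (suc K) * V     ∎
  where open ≤-Reasoning

Sum-shrinking : ∀ t (f : ℕ → ℕ) U V → (∀ k → f (suc k) * U ≤ f k * V) →
  Sum f t * U ≤ Sum f t * V + f 0 * U
Sum-shrinking zero f U V h = z≤n
Sum-shrinking (suc t) f U V h = begin
  (f 0 + S) * U               ≡⟨ *-distribʳ-+ U (f 0) S ⟩
  f 0 * U + S * U             ≤⟨ +-monoʳ-≤ (f 0 * U) (Sum-shrinking t (λ i → f (suc i)) U V (λ k → h (suc k))) ⟩
  f 0 * U + (S * V + f 1 * U) ≤⟨ +-monoʳ-≤ (f 0 * U) (+-monoʳ-≤ (S * V) (h 0)) ⟩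
  f 0 * U + (S * V + f 0 * V) ≡⟨ collect (f 0) U S V ⟩
  (f 0 + S) * V + f 0 * U     ∎
  where
  open ≤-Reasoning
  S : ℕ
  S = Sum (λ i → f (suc i)) t
  collect : ∀ a u s v → a * u + (s * v + a * v) ≡ (a + s) * v + a * u
  collect = solve-∀

≤-from-gap : ∀ S U V F → suc V ≤ U → S * U ≤ S * V + F → S ≤ F
≤-from-gap S U V F V<U h = +-cancelˡ-≤ (S * V) S F (begin
  S * V + S ≡⟨ +-comm (S * V) S ⟩
  S + S * V ≡⟨ *-suc S V ⟨
  S * suc V ≤⟨ *-monoʳ-≤ S V<U ⟩
  S * U     ≤⟨ h ⟩
  S * V + F ∎)
  where open ≤-Reasoning

growth-chain : ∀ d K (f : ℕ → ℕ) U V → (∀ i → i < d → f (K + i) * U ≤ f (K + suc i) * V) →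
  f K * U ^ d ≤ f (K + d) * V ^ d
growth-chain zero K f U V h = subst (λ t → f K * 1 ≤ f t * 1) (sym (+-identityʳ K)) ≤-refl
growth-chain (suc d) K f U V h = begin
  f K * (U * U ^ d)           ≡⟨ swap (f K) U (U ^ d) ⟩
  (f K * U ^ d) * U           ≤⟨ *-monoˡ-≤ U (growth-chain d K f U V (λ i i<d → h i (m<n⇒m<1+n i<d))) ⟩
  (f (K + d) * V ^ d) * U     ≡⟨ exchange (f (K + d)) (V ^ d) U ⟩
  (f (K + d) * U) * V ^ d     ≤⟨ *-monoˡ-≤ (V ^ d) (h d (n<1+n d)) ⟩
  (f (K + suc d) * V) * V ^ d ≡⟨ *-assoc (f (K + suc d)) V (V ^ d) ⟩
  f (K + suc d) * (V * V ^ d) ∎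
  where
  open ≤-Reasoning
  swap : ∀ a b c → a * (b * c) ≡ (a * c) * b
  swap = solve-∀
  exchange : ∀ a b c → (a * b) * c ≡ (a * c) * b
  exchange = solve-∀

decay-chain : ∀ d J (f : ℕ → ℕ) U V → (∀ i → i < d → f (J + suc i) * U ≤ f (J + i) * V) →
  f (J + d) * U ^ d ≤ f J * V ^ d
decay-chain zero J f U V h = subst (λ t → f t * 1 ≤ f J * 1) (sym (+-identityʳ J)) ≤-refl
decay-chain (suc d) J f U V h = begin
  f (J + suc d) * (U * U ^ d) ≡⟨ *-assoc (f (J + suc d)) U (U ^ d) ⟨
  (f (J + suc d) * U) * U ^ d ≤⟨ *-monoˡ-≤ (U ^ d) (h d (n<1+n d)) ⟩
  (f (J + d) * V) * U ^ d     ≡⟨ swap (f (J + d)) V (U ^ d) ⟩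
  (f (J + d) * U ^ d) * V     ≤⟨ *-monoˡ-≤ V (decay-chain d J f U V (λ i i<d → h i (m<n⇒m<1+n i<d))) ⟩
  (f J * V ^ d) * V           ≡⟨ regroup (f J) (V ^ d) V ⟩
  f J * (V * V ^ d)           ∎
  where
  open ≤-Reasoning
  swap : ∀ a b c → (a * b) * c ≡ (a * c) * b
  swap = solve-∀
  regroup : ∀ a b c → (a * b) * c ≡ a * (c * b)
  regroup = solve-∀

bernoulli : ∀ v d → v ^ d * (v + d) ≤ v * suc v ^ d
bernoulli v zero = subst₂ _≤_ (sym (trans (*-identityˡ (v + 0)) (+-identityʳ v))) (sym (*-identityʳ v)) ≤-refl
bernoulli v (suc d) = begin
  v * v ^ d * (v + suc d)                ≡⟨ expand v (v ^ d) d ⟩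
  v ^ d * (v + d) * v + v ^ d * v        ≤⟨ +-monoʳ-≤ (v ^ d * (v + d) * v) (*-monoʳ-≤ (v ^ d) (m≤m+n v d)) ⟩
  v ^ d * (v + d) * v + v ^ d * (v + d)  ≡⟨ collect (v ^ d * (v + d)) v ⟩
  v ^ d * (v + d) * suc v                ≤⟨ *-monoˡ-≤ (suc v) (bernoulli v d) ⟩
  v * suc v ^ d * suc v                  ≡⟨ regroup v (suc v ^ d) (suc v) ⟩
  v * (suc v * suc v ^ d)                ∎
  where
  open ≤-Reasoning
  expand : ∀ v p d → v * p * (v + suc d) ≡ p * (v + d) * v + p * v
  expand = solve-∀
  collect : ∀ x v → x * v + x ≡ x * suc v
  collect = solve-∀
  regroup : ∀ a b c → a * b * c ≡ a * (c * b)
  regroup = solve-∀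

power-beats-constant : ∀ M V U d → 1 ≤ V → suc V ≤ U → M * V ≤ d → M * V ^ d < U ^ d
power-beats-constant M V U d V≥1 V<U MV≤d =
  <-≤-trans (*-cancelˡ-< V (M * V ^ d) (suc V ^ d) scaled) (^-monoˡ-≤ d V<U)
  where
  open ≤-Reasoning
  Vᵈ≢0 : NonZero (V ^ d)
  Vᵈ≢0 = m^n≢0 V d {{>-nonZero V≥1}}
  MV<V+d : M * V < V + d
  MV<V+d = <-≤-trans (subst (_< V + M * V) (+-identityˡ _) (+-monoˡ-< (M * V) V≥1)) (+-monoʳ-≤ V MV≤d)
  scaled : V * (M * V ^ d) < V * suc V ^ d
  scaled = begin-strict
    V * (M * V ^ d) ≡⟨ regroup V M (V ^ d) ⟩
    V ^ d * (M * V) <⟨ *-monoʳ-< (V ^ d) {{Vᵈ≢0}} MV<V+d ⟩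
    V ^ d * (V + d) ≤⟨ bernoulli V d ⟩
    V * suc V ^ d   ∎
    where
    regroup : ∀ v m p → v * (m * p) ≡ p * (m * v)
    regroup = solve-∀

dominated : ∀ S F M X Y → 1 ≤ S → S * Y ≤ F * X → M * X < Y → M * S < F
dominated S F M X Y S≥1 SY≤FX MX<Y = *-cancelʳ-< Y (M * S) F (begin-strict
  M * S * Y   ≡⟨ *-assoc M S Y ⟩
  M * (S * Y) ≤⟨ *-monoʳ-≤ M SY≤FX ⟩
  M * (F * X) ≡⟨ regroup M F X ⟩
  F * (M * X) <⟨ *-monoʳ-< F {{>-nonZero F≥1}} MX<Y ⟩
  F * Y       ∎)
  where
  open ≤-Reasoning
  -- F·X ≥ S·Y ≥ 1, so F ≠ 0.
  F≥1 : 1 ≤ F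
  F≥1 = left-positive F X (≤-trans (*-mono-≤ S≥1 (≤-trans (s≤s z≤n) MX<Y)) SY≤FX)
    where
    left-positive : ∀ a b → 1 ≤ a * b → 1 ≤ a
    left-positive (suc _) _ _ = s≤s z≤n
  regroup : ∀ m f x → m * (f * x) ≡ f * (m * x)
  regroup = solve-∀

-- The head is negligible: if f grows by the factor U/V > 1 at every step
-- before K + d, where d ≥ M·V², then M·Σ_{k<K} f k < H for every H ≥ f(K+d)
-- (with H ≥ 1 in case the head is zero).
head-negligible : ∀ (f : ℕ → ℕ) K d U V M H →
  (∀ k → k < K + d → f k * U ≤ f (suc k) * V) →
  suc V ≤ U → 1 ≤ V → M * V * V ≤ d → f (K + d) ≤ H → 1 ≤ Sum f K + H →
  M * Sum f K < H
head-negligible f K d U V M H grows V<U V≥1 d-large fKd≤H nonempty with Sum f K in eq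
... | zero = subst (_< H) (sym (*-zeroʳ M)) nonempty
... | suc S' = <-≤-trans (dominated S (f (K + d)) M (V * V ^ d) (U ^ d) (s≤s z≤n) bound gap) fKd≤H
  where
  open ≤-Reasoning
  S : ℕ
  S = suc S'
  S≤ : S ≤ f K * V
  S≤ = ≤-from-gap S U V (f K * V) V<U
    (subst (λ s → s * U ≤ s * V + f K * V) eq (Sum-growing K f U V (λ k k<K → grows k (≤-trans k<K (m≤m+n K d)))))
  chain : f K * U ^ d ≤ f (K + d) * V ^ d
  chain = growth-chain d K f U V (λ i i<d →
    subst (λ t → f (K + i) * U ≤ f t * V) (sym (+-suc K i)) (grows (K + i) (+-monoʳ-< K i<d)))
  bound : S * U ^ d ≤ f (K + d) * (V * V ^ d)
  bound = begin
    S * U ^ d             ≤⟨ *-monoˡ-≤ (U ^ d) S≤ ⟩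
    f K * V * U ^ d       ≡⟨ exchange (f K) V (U ^ d) ⟩
    f K * U ^ d * V       ≤⟨ *-monoˡ-≤ V chain ⟩
    f (K + d) * V ^ d * V ≡⟨ regroup (f (K + d)) (V ^ d) V ⟩
    f (K + d) * (V * V ^ d) ∎
    where
    exchange : ∀ a b c → a * b * c ≡ a * c * b
    exchange = solve-∀
    regroup : ∀ a b c → a * b * c ≡ a * (c * b)
    regroup = solve-∀
  gap : M * (V * V ^ d) < U ^ d
  gap = subst (_< U ^ d) (*-assoc M V (V ^ d)) (power-beats-constant (M * V) V U d V≥1 V<U d-large)

-- The tail is negligible: if f shrinks by V/U < 1 at every step from J on,
-- where d ≥ M·U·V, then M·Σ_{i<t} f(J+d+i) < H for every H ≥ f(J), H ≥ 1.
tail-negligible : ∀ (f : ℕ → ℕ) J d t U V M H →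
  (∀ k → J ≤ k → f (suc k) * U ≤ f k * V) →
  suc V ≤ U → 1 ≤ V → M * U * V ≤ d → f J ≤ H → 1 ≤ H →
  M * Sum (λ i → f (J + d + i)) t < H
tail-negligible f J d t U V M H shrinks V<U V≥1 d-large fJ≤H H≥1 with Sum (λ i → f (J + d + i)) t in eq
... | zero = subst (_< H) (sym (*-zeroʳ M)) H≥1
... | suc T' = <-≤-trans (dominated T (f J) M (U * V ^ d) (U ^ d) (s≤s z≤n) bound gap) fJ≤H
  where
  open ≤-Reasoning
  T : ℕ
  T = suc T'
  g : ℕ → ℕ
  g i = f (J + d + i)
  T≤ : T ≤ f (J + d) * U
  T≤ = ≤-from-gap T U V (f (J + d) * U) V<U
    (subst₂ (λ s j → s * U ≤ s * V + f j * U) eq (+-identityʳ (J + d))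
      (Sum-shrinking t g U V (λ i → subst (λ x → f x * U ≤ g i * V) (sym (+-suc (J + d) i))
        (shrinks (J + d + i) (≤-trans (m≤m+n J d) (m≤m+n (J + d) i))))))
  chain : f (J + d) * U ^ d ≤ f J * V ^ d
  chain = decay-chain d J f U V (λ i i<d →
    subst (λ x → f x * U ≤ f (J + i) * V) (sym (+-suc J i)) (shrinks (J + i) (m≤m+n J i)))
  bound : T * U ^ d ≤ f J * (U * V ^ d)
  bound = begin
    T * U ^ d             ≤⟨ *-monoˡ-≤ (U ^ d) T≤ ⟩
    f (J + d) * U * U ^ d ≡⟨ exchange (f (J + d)) U (U ^ d) ⟩
    f (J + d) * U ^ d * U ≤⟨ *-monoˡ-≤ U chain ⟩
    f J * V ^ d * U       ≡⟨ regroup (f J) (V ^ d) U ⟩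
    f J * (U * V ^ d)     ∎
    where
    exchange : ∀ a b c → a * b * c ≡ a * c * b
    exchange = solve-∀
    regroup : ∀ a b c → a * b * c ≡ a * (c * b)
    regroup = solve-∀
  gap : M * (U * V ^ d) < U ^ d
  gap = subst (_< U ^ d) (*-assoc M U (V ^ d)) (power-beats-constant (M * U) V U d V≥1 V<U d-large)

-- The k-step growth factor near a lower approximant.  Here s = e(Q+e) with
-- e(Q+e)+1 = Q², so (Q+e)/Q < φ.
growth-factor-bound : ∀ Q e k w E₃ → e * (Q + e) + 1 ≡ Q * Q → Q * suc k ≤ e * w + E₃ →
  2 * (E₃ * (e + (Q + e))) + 2 * (E₃ * E₃) + 1 ≤ w →
  suc k * (k + suc w) * (2 * (e * (Q + e)) + 2) ≤ suc w * w * (2 * (e * (Q + e)) + 1)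
growth-factor-bound Q e k w E₃ pell k-small w-large = *-cancelˡ-≤ (suc s) (begin
  suc s * (Z * (2 * s + 2))                              ≡⟨ alg₁ s Z ⟩
  (s + 1) * Z * (2 * s + 2)                              ≡⟨ cong (λ t → t * Z * (2 * s + 2)) pell ⟩
  Q * Q * Z * (2 * s + 2)                                ≡⟨ cong (_* (2 * s + 2)) (alg₂ Q k w) ⟩
  (Q * suc k) * (Q * (k + suc w)) * (2 * s + 2)          ≤⟨ *-monoˡ-≤ (2 * s + 2) (*-mono-≤ k-small k+w-small) ⟩
  (e * w + E₃) * ((Q + e) * w + E₃) * (2 * s + 2)        ≡⟨ alg₃ e Q w E₃ ⟩
  suc s * (2 * s * (w * w) + (2 * X * w + 2 * Y))        ≤⟨ *-monoʳ-≤ (suc s) (+-monoʳ-≤ (2 * s * (w * w)) error-small) ⟩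
  suc s * (2 * s * (w * w) + (2 * s * w + w * w + w))    ≡⟨ alg₄ s w ⟩
  suc s * (suc w * w * (2 * s + 1))                      ∎)
  where
  open ≤-Reasoning
  s X Y Z : ℕ
  s = e * (Q + e)
  X = E₃ * (e + (Q + e))
  Y = E₃ * E₃
  Z = suc k * (k + suc w)
  k+w-small : Q * (k + suc w) ≤ (Q + e) * w + E₃
  k+w-small = begin
    Q * (k + suc w)    ≡⟨ expand Q k w ⟩
    Q * suc k + Q * w  ≤⟨ +-monoˡ-≤ (Q * w) k-small ⟩
    e * w + E₃ + Q * w ≡⟨ collect e w E₃ Q ⟩
    (Q + e) * w + E₃   ∎
    where
    expand : ∀ Q k w → Q * (k + suc w) ≡ Q * suc k + Q * w
    expand = solve-∀
    collect : ∀ e w E₃ Q → e * w + E₃ + Q * w ≡ (Q + e) * w + E₃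
    collect = solve-∀
  w≥1 : 1 ≤ w
  w≥1 = ≤-trans (m≤n+m 1 _) w-large
  -- the contribution of E₃ is dominated by w² since w ≥ 2X + 2Y + 1
  error-small : 2 * X * w + 2 * Y ≤ 2 * s * w + w * w + w
  error-small = begin
    2 * X * w + 2 * Y         ≤⟨ +-monoʳ-≤ (2 * X * w) (subst (_≤ 2 * Y * w) (*-identityʳ (2 * Y)) (*-monoʳ-≤ (2 * Y) w≥1)) ⟩
    2 * X * w + 2 * Y * w     ≤⟨ m≤m+n _ w ⟩
    2 * X * w + 2 * Y * w + w ≡⟨ collect X Y w ⟩
    (2 * X + 2 * Y + 1) * w   ≤⟨ *-monoˡ-≤ w w-large ⟩
    w * w                     ≤⟨ m≤n+m (w * w) (2 * s * w) ⟩
    2 * s * w + w * w         ≤⟨ m≤m+n _ w ⟩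
    2 * s * w + w * w + w     ∎
    where
    collect : ∀ X Y w → 2 * X * w + 2 * Y * w + w ≡ (2 * X + 2 * Y + 1) * w
    collect = solve-∀
  alg₁ : ∀ s Z → suc s * (Z * (2 * s + 2)) ≡ (s + 1) * Z * (2 * s + 2)
  alg₁ = solve-∀
  alg₂ : ∀ Q k w → Q * Q * (suc k * (k + suc w)) ≡ (Q * suc k) * (Q * (k + suc w))
  alg₂ = solve-∀
  alg₃ : ∀ e Q w E₃ → (e * w + E₃) * ((Q + e) * w + E₃) * (2 * (e * (Q + e)) + 2) ≡
    suc (e * (Q + e)) * (2 * (e * (Q + e)) * (w * w) + (2 * (E₃ * (e + (Q + e))) * w + 2 * (E₃ * E₃)))
  alg₃ = solve-∀
  alg₄ : ∀ s w → suc s * (2 * s * (w * w) + (2 * s * w + w * w + w)) ≡ suc s * (suc w * w * (2 * s + 1))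
  alg₄ = solve-∀

-- The k-step decay factor near an upper approximant, e(Q+e) = Q² + 1, with
-- q = Q²: the ratio (w+1)w / ((k+1)(k+1+w)) is at most 2q/(2q+1).
-- First the easy regime k ≥ 2(w+1), where the ratio is below 1/4.
decay-factor-large-k : ∀ Q k w → 1 ≤ Q → 2 * suc w ≤ k →
  suc w * w * (2 * (Q * Q) + 1) ≤ suc k * (k + suc w) * (2 * (Q * Q))
decay-factor-large-k Q k w Q≥1 k-large = begin
  suc w * w * (2 * q + 1)             ≤⟨ *-monoˡ-≤ (2 * q + 1) (*-monoʳ-≤ (suc w) (n≤1+n w)) ⟩
  suc w * suc w * (2 * q + 1)         ≤⟨ *-monoʳ-≤ (suc w * suc w) 2q+1≤8q ⟩
  suc w * suc w * (8 * q)             ≡⟨ regroup (suc w) q ⟩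
  (2 * suc w) * (2 * suc w) * (2 * q) ≤⟨ *-monoˡ-≤ (2 * q) (*-mono-≤ (≤-trans k-large (n≤1+n k)) (≤-trans k-large (m≤m+n k (suc w)))) ⟩
  suc k * (k + suc w) * (2 * q)       ∎
  where
  open ≤-Reasoning
  q : ℕ
  q = Q * Q
  2q+1≤8q : 2 * q + 1 ≤ 8 * q
  2q+1≤8q = subst (2 * q + 1 ≤_) (collect q) (+-monoʳ-≤ (2 * q) (≤-trans (*-mono-≤ Q≥1 Q≥1) (m≤m+n q _)))
    where
    collect : ∀ q → 2 * q + (q + 5 * q) ≡ 8 * q
    collect = solve-∀
  regroup : ∀ a q → a * a * (8 * q) ≡ (2 * a) * (2 * a) * (2 * q)
  regroup = solve-∀

-- At an upper approximant, e·w ≤ Q·k + E bounds (Q²+1)·w² = (e·w)·((Q+e)·w)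
-- by the product of the two estimates e·w ≤ Q·k + E and (Q+e)·w ≤ Q(k+1+w) + E.
decay-square-bound : ∀ Q e k w E → e * (Q + e) ≡ Q * Q + 1 → e * w ≤ Q * k + E →
  (Q * Q + 1) * (w * w) ≤ Q * Q * (k * (k + suc w)) + E * Q * (2 * k + suc w) + E * E
decay-square-bound Q e k w E pell w-small = begin
  (Q * Q + 1) * (w * w)               ≡⟨ cong (_* (w * w)) (sym pell) ⟩
  e * (Q + e) * (w * w)               ≡⟨ alg₁ e Q w ⟩
  (e * w) * ((Q + e) * w)             ≤⟨ *-mono-≤ w-small k+w-large ⟩
  (Q * k + E) * (Q * (k + suc w) + E) ≡⟨ alg₂ Q k E w ⟩
  Q * Q * (k * (k + suc w)) + E * Q * (2 * k + suc w) + E * E ∎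
  where
  open ≤-Reasoning
  k+w-large : (Q + e) * w ≤ Q * (k + suc w) + E
  k+w-large = begin
    (Q + e) * w           ≡⟨ expand Q e w ⟩
    e * w + Q * w         ≤⟨ +-mono-≤ w-small (*-monoʳ-≤ Q (n≤1+n w)) ⟩
    Q * k + E + Q * suc w ≡⟨ collect Q k E w ⟩
    Q * (k + suc w) + E   ∎
    where
    expand : ∀ Q e w → (Q + e) * w ≡ e * w + Q * w
    expand = solve-∀
    collect : ∀ Q k E w → Q * k + E + Q * suc w ≡ Q * (k + suc w) + E
    collect = solve-∀
  alg₁ : ∀ e Q w → e * (Q + e) * (w * w) ≡ (e * w) * ((Q + e) * w)
  alg₁ = solve-∀
  alg₂ : ∀ Q k E w → (Q * k + E) * (Q * (k + suc w) + E) ≡ Q * Q * (k * (k + suc w)) + E * Q * (2 * k + suc w) + E * E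
  alg₂ = solve-∀

decay-error-small : ∀ E Q w → 16 * E * Q + 2 * E * E + 1 ≤ w → 16 * E * Q * w + 2 * (E * E) + w ≤ w * w
decay-error-small E Q w w-large = begin
  16 * E * Q * w + 2 * (E * E) + w   ≤⟨ +-monoˡ-≤ w (+-monoʳ-≤ (16 * E * Q * w) (subst (_≤ 2 * E * E * w) (alg₁ E) (*-monoʳ-≤ (2 * E * E) w≥1))) ⟩
  16 * E * Q * w + 2 * E * E * w + w ≡⟨ alg₂ E Q w ⟩
  (16 * E * Q + 2 * E * E + 1) * w   ≤⟨ *-monoˡ-≤ w w-large ⟩
  w * w                              ∎
  where
  open ≤-Reasoning
  w≥1 : 1 ≤ w
  w≥1 = ≤-trans (m≤n+m 1 _) w-large
  alg₁ : ∀ E → 2 * E * E * 1 ≡ 2 * (E * E)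
  alg₁ = solve-∀
  alg₂ : ∀ E Q w → 16 * E * Q * w + 2 * E * E * w + w ≡ (16 * E * Q + 2 * E * E + 1) * w
  alg₂ = solve-∀

decay-factor-small-k : ∀ Q e k w E → e * (Q + e) ≡ Q * Q + 1 → e * w ≤ Q * k + E →
  k ≤ 2 * w + 1 → 16 * E * Q + 2 * E * E + 1 ≤ w →
  suc w * w * (2 * (Q * Q) + 1) ≤ suc k * (k + suc w) * (2 * (Q * Q))
decay-factor-small-k Q e k w E pell w-small k≤2w+1 w-large = begin
  suc w * w * (2 * q + 1)                 ≡⟨ expand q w ⟩
  2 * q * (w * w) + w * w + w + 2 * q * w ≤⟨ +-monoˡ-≤ (2 * q * w) key ⟩
  2 * q * KK + 2 * q * w                  ≤⟨ +-monoʳ-≤ (2 * q * KK) (*-monoʳ-≤ (2 * q) (≤-trans (m≤n+m w k) (+-monoʳ-≤ k (n≤1+n w)))) ⟩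
  2 * q * KK + 2 * q * (k + suc w)        ≡⟨ collect q k w ⟩
  suc k * (k + suc w) * (2 * q)           ∎
  where
  open ≤-Reasoning
  q KK : ℕ
  q = Q * Q
  KK = k * (k + suc w)
  -- k ≤ 2w + 1 turns the cross term E·Q·(2k+w+1) into at most 8EQw
  square-bound : (q + 1) * (w * w) ≤ q * KK + 8 * E * Q * w + E * E
  square-bound = ≤-trans (decay-square-bound Q e k w E pell w-small) (+-monoˡ-≤ (E * E) (+-monoʳ-≤ (q * KK)
    (subst (E * Q * (2 * k + suc w) ≤_) (regroup E Q w) (*-monoʳ-≤ (E * Q) 2k+w+1≤8w))))
    where
    w≥1 : 1 ≤ w
    w≥1 = ≤-trans (m≤n+m 1 _) w-large
    2k+w+1≤8w : 2 * k + suc w ≤ 8 * w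
    2k+w+1≤8w = begin
      2 * k + suc w           ≤⟨ +-monoˡ-≤ (suc w) (*-monoʳ-≤ 2 k≤2w+1) ⟩
      2 * (2 * w + 1) + suc w ≡⟨ alg₁ w ⟩
      5 * w + 3               ≤⟨ +-monoʳ-≤ (5 * w) (*-monoʳ-≤ 3 w≥1) ⟩
      5 * w + 3 * w           ≡⟨ alg₂ w ⟩
      8 * w                   ∎
      where
      alg₁ : ∀ w → 2 * (2 * w + 1) + suc w ≡ 5 * w + 3
      alg₁ = solve-∀
      alg₂ : ∀ w → 5 * w + 3 * w ≡ 8 * w
      alg₂ = solve-∀
    regroup : ∀ E Q w → E * Q * (8 * w) ≡ 8 * E * Q * w
    regroup = solve-∀
  key : 2 * q * (w * w) + w * w + w ≤ 2 * q * KK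
  key = +-cancelʳ-≤ (16 * E * Q * w + 2 * (E * E)) _ _ (begin
    2 * q * (w * w) + w * w + w + (16 * E * Q * w + 2 * (E * E)) ≡⟨ alg₁ q w E Q ⟩
    2 * q * (w * w) + w * w + (16 * E * Q * w + 2 * (E * E) + w) ≤⟨ +-monoʳ-≤ (2 * q * (w * w) + w * w) (decay-error-small E Q w w-large) ⟩
    2 * q * (w * w) + w * w + w * w                               ≡⟨ alg₂ q w ⟩
    2 * ((q + 1) * (w * w))                                       ≤⟨ *-monoʳ-≤ 2 square-bound ⟩
    2 * (q * KK + 8 * E * Q * w + E * E)                          ≡⟨ alg₃ q KK E Q w ⟩
    2 * q * KK + (16 * E * Q * w + 2 * (E * E))                   ∎)
    where
    alg₁ : ∀ q w E Q → 2 * q * (w * w) + w * w + w + (16 * E * Q * w + 2 * (E * E)) ≡ 2 * q * (w * w) + w * w + (16 * E * Q * w + 2 * (E * E) + w)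
    alg₁ = solve-∀
    alg₂ : ∀ q w → 2 * q * (w * w) + w * w + w * w ≡ 2 * ((q + 1) * (w * w))
    alg₂ = solve-∀
    alg₃ : ∀ q KK E Q w → 2 * (q * KK + 8 * E * Q * w + E * E) ≡ 2 * q * KK + (16 * E * Q * w + 2 * (E * E))
    alg₃ = solve-∀
  expand : ∀ q w → suc w * w * (2 * q + 1) ≡ 2 * q * (w * w) + w * w + w + 2 * q * w
  expand = solve-∀
  collect : ∀ q k w → 2 * q * (k * (k + suc w)) + 2 * q * (k + suc w) ≡ suc k * (k + suc w) * (2 * q)
  collect = solve-∀

-- Combining both regimes; the size condition on n = 2k+1+w forces w ≥ 16EQ + 2E² + 1
-- whenever k ≤ 2w + 1.
decay-factor-bound : ∀ Q e k w E → e * (Q + e) ≡ Q * Q + 1 → 1 ≤ Q → e * w ≤ Q * k + E →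
  5 * (16 * E * Q + 2 * E * E + 1) + 3 ≤ k + suc (k + w) →
  suc w * w * (2 * (Q * Q) + 1) ≤ suc k * (k + suc w) * (2 * (Q * Q))
decay-factor-bound Q e k w E pell Q≥1 w-small n-large with 2 * suc w ≤? k
... | yes k-large = decay-factor-large-k Q k w Q≥1 k-large
... | no k-small = decay-factor-small-k Q e k w E pell w-small k≤2w+1 w-large
  where
  W : ℕ
  W = 16 * E * Q + 2 * E * E + 1
  k≤2w+1 : k ≤ 2 * w + 1
  k≤2w+1 = ≤-pred (subst (k <_) (alg₁ w) (≰⇒> k-small))
    where
    alg₁ : ∀ w → 2 * suc w ≡ suc (2 * w + 1)
    alg₁ = solve-∀
  w-large : W ≤ w
  w-large = *-cancelˡ-≤ 5 (+-cancelʳ-≤ 3 (5 * W) (5 * w) (≤-trans n-large (begin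
    k + suc (k + w)                 ≤⟨ +-mono-≤ k≤2w+1 (s≤s (+-monoˡ-≤ w k≤2w+1)) ⟩
    2 * w + 1 + suc (2 * w + 1 + w) ≡⟨ alg₂ w ⟩
    5 * w + 3                       ∎)))
    where
    open ≤-Reasoning
    alg₂ : ∀ w → 2 * w + 1 + suc (2 * w + 1 + w) ≡ 5 * w + 3
    alg₂ = solve-∀

-- Fix a lower approximant P/Q of φ = (1+√5)/2 with P = Q + e
-- and e(Q+e) + 1 = Q²; write R = Q + 2e.  Split D_n at K ≈ e(n+1)/R: beyond K
-- every term grows with n by at least the factor (P/Q)^m (n-ratio-above),
-- while below K + d the terms increase in k by a fixed factor U/V > 1
-- (growth-factor-bound), so the part of D_n below K is negligible.
module LowerBound (Q e t A B : ℕ) (pell : e * (Q + e) + 1 ≡ Q * Q) (Q≥1 : 1 ≤ Q)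
                  (AQᵐ<BPᵐ : A * Q ^ suc t < B * (Q + e) ^ suc t) where
  m P R s u v U V M d E₁ E₃ W₀ N : ℕ
  m = suc t
  P = Q + e
  R = Q + 2 * e
  s = e * (Q + e)
  -- the k-step growth factor u/v and its m-th power U/V
  u = 2 * s + 2
  v = 2 * s + 1
  U = u ^ m
  V = v ^ m
  M = A * Q ^ m
  -- d steps of growth make the head negligible against M
  d = M * V * V
  E₁ = R * d
  E₃ = 2 * e + E₁ + Q
  W₀ = 2 * (E₃ * (e + (Q + e))) + 2 * (E₃ * E₃) + 1
  N = 2 * e + 2 * E₁ + R * (1 + W₀)

  instance
    R≢0 : NonZero R
    R≢0 = >-nonZero (≤-trans Q≥1 (m≤m+n Q _))

  V<U : suc V ≤ U
  V<U = subst (λ z → suc V ≤ z ^ m) (alg s) (^-monoˡ-< m (n<1+n v))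
    where
    alg : ∀ s → suc (2 * s + 1) ≡ 2 * s + 2
    alg = solve-∀
  V≥1 : 1 ≤ V
  V≥1 = subst (_≤ V) (^-zeroˡ m) (^-monoˡ-≤ m (m≤n+m 1 (2 * s)))

  module AtLevel (n : ℕ) (N≤n : N ≤ n) where
    open ≤-Reasoning
    x K : ℕ
    x = e * suc n
    K = x / R + 1
    f : ℕ → ℕ
    f k = term n k ^ m
    g : ℕ → ℕ
    g k = term (suc n) k ^ m

    R[x/R]≤x : R * (x / R) ≤ x
    R[x/R]≤x = subst (_≤ x) (*-comm (x / R) R) (m/n*n≤m x R)
    x<RK : x < R * K
    x<RK = subst₂ _<_ (sym (m≡m%n+[m/n]*n x R)) (alg (x / R) R) (+-monoˡ-< ((x / R) * R) (m%n<n x R))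
      where
      alg : ∀ q R → R + q * R ≡ R * (q + 1)
      alg = solve-∀

    below-split : ∀ k → k < K + d → R * k ≤ x + E₁
    below-split k k< = +-cancelˡ-≤ R _ _ (begin
      R + R * k                 ≡⟨ *-suc R k ⟨
      R * suc k                 ≤⟨ *-monoʳ-≤ R k< ⟩
      R * (K + d)               ≡⟨ alg R (x / R) d ⟩
      R * (x / R) + R + E₁      ≤⟨ +-monoˡ-≤ E₁ (+-monoˡ-≤ R R[x/R]≤x) ⟩
      x + R + E₁                ≡⟨ alg′ x R E₁ ⟩
      R + (x + E₁)              ∎)
      where
      alg : ∀ R q d → R * (q + 1 + d) ≡ R * q + R + R * d
      alg = solve-∀
      alg′ : ∀ x R E₁ → x + R + E₁ ≡ R + (x + E₁)
      alg′ = solve-∀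

    room : ∀ k → k < K + d → k + suc k + W₀ ≤ n
    room k k< = *-cancelˡ-≤ R (begin
      R * (k + suc k + W₀)                  ≡⟨ alg₁ R k W₀ ⟩
      2 * (R * k) + R * (1 + W₀)            ≤⟨ +-monoˡ-≤ (R * (1 + W₀)) (*-monoʳ-≤ 2 (below-split k k<)) ⟩
      2 * (e * suc n + E₁) + R * (1 + W₀)   ≡⟨ alg₂ e n E₁ R W₀ ⟩
      2 * e * n + N                         ≤⟨ +-monoʳ-≤ (2 * e * n) N≤n ⟩
      2 * e * n + n                         ≤⟨ +-monoʳ-≤ (2 * e * n) (subst (_≤ Q * n) (*-identityˡ n) (*-monoˡ-≤ n Q≥1)) ⟩
      2 * e * n + Q * n                     ≡⟨ alg₃ e n Q ⟩
      R * n                                 ∎)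
      where
      alg₁ : ∀ R k W₀ → R * (k + suc k + W₀) ≡ 2 * (R * k) + R * (1 + W₀)
      alg₁ = solve-∀
      alg₂ : ∀ e n E₁ R W₀ → 2 * (e * suc n + E₁) + R * (1 + W₀) ≡ 2 * e * n + (2 * e + 2 * E₁ + R * (1 + W₀))
      alg₂ = solve-∀
      alg₃ : ∀ e n Q → 2 * e * n + Q * n ≡ (Q + 2 * e) * n
      alg₃ = solve-∀

    grows : ∀ k → k < K + d → f k * U ≤ f (suc k) * V
    grows k k< = pow-mono m (term n k) u (term n (suc k)) v (subst (λ z → term z k * u ≤ term z (suc k) * v) n≡
      (k-step-above k w u v (growth-factor-bound Q e k w E₃ pell k-small w-large)))
      where
      2k+1≤n : k + suc k ≤ n
      2k+1≤n = ≤-trans (m≤m+n _ W₀) (room k k<)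
      w : ℕ
      w = n ∸ (k + suc k)
      n≡ : k + suc (k + w) ≡ n
      n≡ = trans (alg k w) (m+[n∸m]≡n 2k+1≤n)
        where
        alg : ∀ k w → k + suc (k + w) ≡ k + suc k + w
        alg = solve-∀
      w-large : W₀ ≤ w
      w-large = +-cancelˡ-≤ (k + suc k) W₀ w (subst (k + suc k + W₀ ≤_) (sym (m+[n∸m]≡n 2k+1≤n)) (room k k<))
      k-small : Q * suc k ≤ e * w + E₃
      k-small = begin
        Q * suc k           ≡⟨ *-suc Q k ⟩
        Q + Q * k           ≤⟨ +-monoʳ-≤ Q (+-cancelʳ-≤ (2 * e * k) _ _ (begin
            Q * k + 2 * e * k               ≡⟨ alg₁ Q e k ⟩
            R * k                           ≤⟨ below-split k k< ⟩
            e * suc n + E₁                  ≡⟨ cong (λ z → e * suc z + E₁) (sym n≡) ⟩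
            e * suc (k + suc (k + w)) + E₁  ≡⟨ alg₂ e k w E₁ ⟩
            e * w + 2 * e + E₁ + 2 * e * k  ∎)) ⟩
        Q + (e * w + 2 * e + E₁) ≡⟨ alg₃ Q e w E₁ ⟩
        e * w + E₃               ∎
        where
        alg₁ : ∀ Q e k → Q * k + 2 * e * k ≡ (Q + 2 * e) * k
        alg₁ = solve-∀
        alg₂ : ∀ e k w E₁ → e * suc (k + suc (k + w)) + E₁ ≡ e * w + 2 * e + E₁ + 2 * e * k
        alg₂ = solve-∀
        alg₃ : ∀ Q e w E₁ → Q + (e * w + 2 * e + E₁) ≡ e * w + (2 * e + E₁ + Q)
        alg₃ = solve-∀

    K+d≤n : K + d ≤ n
    K+d≤n = subst (_≤ n) (sym K+d≡) (≤-trans (≤-trans (m≤n+m (suc k₀) k₀) (m≤m+n _ W₀))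
      (room k₀ (subst (k₀ <_) (sym K+d≡) (n<1+n k₀))))
      where
      k₀ : ℕ
      k₀ = x / R + d
      K+d≡ : K + d ≡ suc k₀
      K+d≡ = alg (x / R) d
        where
        alg : ∀ a d → a + 1 + d ≡ suc (a + d)
        alg = solve-∀

    L : ℕ
    L = suc n ∸ K
    K+L≡ : K + L ≡ suc n
    K+L≡ = m+[n∸m]≡n (≤-trans (m≤m+n K d) (m≤n⇒m≤1+n K+d≤n))
    S H G : ℕ
    S = Sum f K
    H = Sum (λ i → f (K + i)) L
    G = Sum (λ i → g (K + i)) L
    Dₙ≡S+H : D n m ≡ S + H
    Dₙ≡S+H = trans (D≡Sum n m) (trans (cong (Sum f) (sym K+L≡)) (Sum-split K L f))

    head-small : M * S < H
    head-small = head-negligible f K d U V M H grows V<U V≥1 ≤-refl fK+d≤H nonempty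
      where
      d<L : d < L
      d<L = +-cancelˡ-< K d L (subst (K + d <_) (sym K+L≡) (s≤s K+d≤n))
      fK+d≤H : f (K + d) ≤ H
      fK+d≤H = Sum-term L d (λ i → f (K + i)) d<L
      nonempty : 1 ≤ S + H
      nonempty = subst (1 ≤_) Dₙ≡S+H (D-pos n m)

    tail-grows : P ^ m * H ≤ Q ^ m * G
    tail-grows = subst₂ _≤_ (Sum-scale L (P ^ m) (λ i → f (K + i))) (Sum-scale L (Q ^ m) (λ i → g (K + i)))
      (Sum-mono L _ _ (λ i _ → subst₂ _≤_ (*-comm (f (K + i)) _) (*-comm (g (K + i)) _)
        (pow-mono m (term n (K + i)) P (term (suc n) (K + i)) Q (n-ratio-above Q e n (K + i) (≤-trans (<⇒≤ x<RK) (*-monoʳ-≤ R (m≤m+n K i)))))))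

    G≤Dₙ₊₁ : G ≤ D (suc n) m
    G≤Dₙ₊₁ = begin
      G                     ≤⟨ m≤n+m G (Sum g K) ⟩
      Sum g K + G           ≡⟨ Sum-split K L g ⟨
      Sum g (K + L)         ≡⟨ cong (Sum g) K+L≡ ⟩
      Sum g (suc n)         ≤⟨ Sum-prefix (suc n) (suc (suc n)) g (n≤1+n _) ⟩
      Sum g (suc (suc n))   ≡⟨ D≡Sum (suc n) m ⟨
      D (suc n) m           ∎

    ratio-above : A * D n m < B * D (suc n) m
    ratio-above = *-cancelˡ-< (Q ^ m) (A * D n m) (B * D (suc n) m) (begin-strict
      Q ^ m * (A * D n m)       ≡⟨ cong (λ z → Q ^ m * (A * z)) Dₙ≡S+H ⟩
      Q ^ m * (A * (S + H))     ≡⟨ alg₁ (Q ^ m) A S H ⟩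
      M * S + M * H             <⟨ +-monoˡ-< (M * H) head-small ⟩
      suc M * H                 ≤⟨ *-monoˡ-≤ H AQᵐ<BPᵐ ⟩
      B * P ^ m * H             ≡⟨ *-assoc B (P ^ m) H ⟩
      B * (P ^ m * H)           ≤⟨ *-monoʳ-≤ B tail-grows ⟩
      B * (Q ^ m * G)           ≤⟨ *-monoʳ-≤ B (*-monoʳ-≤ (Q ^ m) G≤Dₙ₊₁) ⟩
      B * (Q ^ m * D (suc n) m) ≡⟨ alg₂ B (Q ^ m) (D (suc n) m) ⟩
      Q ^ m * (B * D (suc n) m) ∎)
      where
      alg₁ : ∀ q A S H → q * (A * (S + H)) ≡ A * q * S + A * q * H
      alg₁ = solve-∀
      alg₂ : ∀ B q D → B * (q * D) ≡ q * (B * D)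
      alg₂ = solve-∀

  lower-bound : ∃[ N ] (∀ n → N ≤ n → A * D n m < B * D (suc n) m)
  lower-bound = N , AtLevel.ratio-above

-- Fix an upper approximant P/Q of φ with P = Q + e
-- and e(Q+e) = Q² + 1.  If B·P^m < A·Q^m, then B·D_{n+1} < A·D_n for all
-- large n.  Split D_{n+1} after K ≈ e(n+1)/R: up to K every term grows with
-- n by at most the factor (P/Q)^m (n-ratio-below), while from K + 1 − d on
-- the terms decrease in k by a fixed factor V/U < 1 (decay-factor-bound), so
-- the part of D_{n+1} beyond K is negligible.
module UpperBound (Q e t A B : ℕ) (pell : e * (Q + e) ≡ Q * Q + 1) (Q≥1 : 1 ≤ Q) (B≥1 : 1 ≤ B)
                  (BPᵐ<AQᵐ : B * (Q + e) ^ suc t < A * Q ^ suc t) where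
  m P R q u v U V M d E W₁ N : ℕ
  m = suc t
  P = Q + e
  R = Q + 2 * e
  q = Q * Q
  -- the k-step decay factor v/u and its m-th power V/U
  u = 2 * q + 1
  v = 2 * q
  U = u ^ m
  V = v ^ m
  M = B * P ^ m
  -- d steps of decay make the tail negligible against M
  d = M * U * V
  E = R * d
  W₁ = 16 * E * Q + 2 * E * E + 1
  N = R * d + (5 * W₁ + 3)

  instance
    R≢0 : NonZero R
    R≢0 = >-nonZero (≤-trans Q≥1 (m≤m+n Q _))
    Qᵐ≢0 : NonZero (Q ^ m)
    Qᵐ≢0 = >-nonZero (subst (_≤ Q ^ m) (^-zeroˡ m) (^-monoˡ-≤ m Q≥1))

  V<U : suc V ≤ U
  V<U = subst (λ z → suc V ≤ z ^ m) (+-comm 1 v) (^-monoˡ-< m (n<1+n v))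
  V≥1 : 1 ≤ V
  V≥1 = subst (_≤ V) (^-zeroˡ m) (^-monoˡ-≤ m (≤-trans (*-mono-≤ Q≥1 Q≥1) (m≤m+n q (q + 0))))
  d≥1 : 1 ≤ d
  d≥1 = *-mono-≤ (*-mono-≤ (*-mono-≤ B≥1 (subst (_≤ P ^ m) (^-zeroˡ m) (^-monoˡ-≤ m (≤-trans Q≥1 (m≤m+n Q e)))))
    (≤-trans (s≤s z≤n) V<U)) V≥1
  e≥1 : 1 ≤ e
  e≥1 = positive e pell
    where
    positive : ∀ e → e * (Q + e) ≡ Q * Q + 1 → 1 ≤ e
    positive zero h = ⊥-elim (0≢1+n (trans h (+-comm (Q * Q) 1)))
    positive (suc _) _ = s≤s z≤n
  e<R : e < R
  e<R = <-≤-trans (subst (_< Q + e) (+-identityˡ e) (+-monoˡ-< e Q≥1)) (+-monoʳ-≤ Q (m≤m+n e (e + 0)))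

  module AtLevel (n : ℕ) (N≤n : N ≤ n) where
    open ≤-Reasoning
    x K' K₀ : ℕ
    x = e * suc n
    -- the split point K' and the start K₀ of the decay region
    K' = x / R
    K₀ = K' + 1 ∸ d
    f : ℕ → ℕ
    f k = term (suc n) k ^ m
    h : ℕ → ℕ
    h k = term n k ^ m

    R[x/R]≤x : R * K' ≤ x
    R[x/R]≤x = subst (_≤ x) (*-comm (x / R) R) (m/n*n≤m x R)
    x<R[K'+1] : x < R * (K' + 1)
    x<R[K'+1] = subst₂ _<_ (sym (m≡m%n+[m/n]*n x R)) (alg (x / R) R) (+-monoˡ-< ((x / R) * R) (m%n<n x R))
      where
      alg : ∀ q R → R + q * R ≡ R * (q + 1)
      alg = solve-∀

    d≤K' : d ≤ K'
    d≤K' = ≤-pred (subst (d <_) (+-comm K' 1) (*-cancelˡ-< R d (K' + 1) (≤-<-trans Rd≤x x<R[K'+1])))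
      where
      Rd≤x : R * d ≤ x
      Rd≤x = ≤-trans (m≤m+n (R * d) _) (≤-trans N≤n (≤-trans (n≤1+n n)
        (subst (_≤ x) (*-identityˡ (suc n)) (*-monoˡ-≤ (suc n) e≥1))))
    K₀+d≡ : K₀ + d ≡ K' + 1
    K₀+d≡ = m∸n+n≡m (≤-trans d≤K' (m≤m+n K' 1))

    shrinks : ∀ k → K₀ ≤ k → f (suc k) * U ≤ f k * V
    shrinks k K₀≤k with term-cases (suc n) (suc k)
    ... | inj₂ n+1<2k+2 = subst (λ z → z ^ m * U ≤ f k * V) (sym (term-vanishes {suc n} {suc k} n+1<2k+2))
                            z≤n
    ... | inj₁ (j , eq) = pow-mono m (term (suc n) (suc k)) u (term (suc n) k) v
          (subst (λ z → term z (suc k) * u ≤ term z k * v) n≡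
            (k-step-below k w u v (decay-factor-bound Q e k w E pell Q≥1 w-small n-large)))
      where
      w : ℕ
      w = suc j
      n≡ : k + suc (k + w) ≡ suc n
      n≡ = trans (alg k j) eq
        where
        alg : ∀ k j → k + suc (k + suc j) ≡ suc k + (suc k + j)
        alg = solve-∀
      w-small : e * w ≤ Q * k + E
      w-small = +-cancelʳ-≤ (2 * e * k) _ _ (begin
        e * w + 2 * e * k       ≤⟨ m≤m+n _ e ⟩
        e * w + 2 * e * k + e   ≡⟨ alg₁ e w k ⟩
        e * (k + suc (k + w))   ≡⟨ cong (e *_) n≡ ⟩
        x                       ≤⟨ <⇒≤ x<R[K'+1] ⟩
        R * (K' + 1)            ≡⟨ cong (R *_) K₀+d≡ ⟨
        R * (K₀ + d)            ≤⟨ *-monoʳ-≤ R (+-monoˡ-≤ d K₀≤k) ⟩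
        R * (k + d)             ≡⟨ alg₂ Q e k d ⟩
        Q * k + R * d + 2 * e * k ∎)
        where
        alg₁ : ∀ e w k → e * w + 2 * e * k + e ≡ e * (k + suc (k + w))
        alg₁ = solve-∀
        alg₂ : ∀ Q e k d → (Q + 2 * e) * (k + d) ≡ Q * k + (Q + 2 * e) * d + 2 * e * k
        alg₂ = solve-∀
      n-large : 5 * W₁ + 3 ≤ k + suc (k + w)
      n-large = subst (5 * W₁ + 3 ≤_) (sym n≡) (≤-trans (m≤n+m _ (R * d)) (≤-trans N≤n (n≤1+n n)))

    K'≤n : K' ≤ n
    K'≤n = ≤-pred (*-cancelˡ-< R K' (suc n) (≤-<-trans R[x/R]≤x (*-monoˡ-< (suc n) e<R)))

    L : ℕ
    L = suc (suc n) ∸ (K' + 1)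
    K'+1+L≡ : K' + 1 + L ≡ suc (suc n)
    K'+1+L≡ = m+[n∸m]≡n (subst (_≤ suc (suc n)) (+-comm 1 K') (s≤s (m≤n⇒m≤1+n K'≤n)))
    S T : ℕ
    S = Sum f (K' + 1)
    T = Sum (λ i → f (K' + 1 + i)) L
    Dₙ₊₁≡S+T : D (suc n) m ≡ S + T
    Dₙ₊₁≡S+T = trans (D≡Sum (suc n) m) (trans (cong (Sum f) (sym K'+1+L≡)) (Sum-split (K' + 1) L f))

    tail-small : M * T < S
    tail-small = subst (λ z → M * Sum (λ i → f (z + i)) L < S) K₀+d≡
      (tail-negligible f K₀ d L U V M S shrinks V<U V≥1 ≤-refl fK₀≤S S≥1)
      where
      fK₀≤S : f K₀ ≤ S
      fK₀≤S = Sum-term (K' + 1) K₀ f (subst (K₀ <_) K₀+d≡ (subst (_≤ K₀ + d) (+-comm K₀ 1) (+-monoʳ-≤ K₀ d≥1)))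
      S≥1 : 1 ≤ S
      S≥1 = subst (_≤ S) (^-zeroˡ m) (Sum-term (K' + 1) 0 f (subst (0 <_) (+-comm 1 K') (s≤s z≤n)))

    head-grows : Q ^ m * S ≤ P ^ m * D n m
    head-grows = begin
      Q ^ m * S                         ≡⟨ Sum-scale (K' + 1) (Q ^ m) f ⟨
      Sum (λ i → Q ^ m * f i) (K' + 1)  ≤⟨ Sum-mono (K' + 1) _ _ termwise ⟩
      Sum (λ i → P ^ m * h i) (K' + 1)  ≡⟨ Sum-scale (K' + 1) (P ^ m) h ⟩
      P ^ m * Sum h (K' + 1)            ≤⟨ *-monoʳ-≤ (P ^ m) (Sum-prefix (K' + 1) (suc n) h (subst (_≤ suc n) (+-comm 1 K') (s≤s K'≤n))) ⟩
      P ^ m * Sum h (suc n)             ≡⟨ cong (P ^ m *_) (D≡Sum n m) ⟨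
      P ^ m * D n m                     ∎
      where
      termwise : ∀ i → i < K' + 1 → Q ^ m * f i ≤ P ^ m * h i
      termwise i i< = subst₂ _≤_ (*-comm (f i) _) (*-comm (h i) _)
        (pow-mono m (term (suc n) i) Q (term n i) P
          (n-ratio-below Q e n i Q≥1 (≤-trans (*-monoʳ-≤ R (≤-pred (subst (i <_) (+-comm K' 1) i<))) R[x/R]≤x)))

    BQᵐT<Dₙ : B * Q ^ m * T < D n m
    BQᵐT<Dₙ = *-cancelˡ-< (P ^ m) (B * Q ^ m * T) (D n m) (begin-strict
      P ^ m * (B * Q ^ m * T) ≡⟨ alg (P ^ m) B (Q ^ m) T ⟩
      Q ^ m * (M * T)         <⟨ *-monoʳ-< (Q ^ m) tail-small ⟩
      Q ^ m * S               ≤⟨ head-grows ⟩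
      P ^ m * D n m           ∎)
      where
      alg : ∀ p b q t → p * (b * q * t) ≡ q * (b * p * t)
      alg = solve-∀

    ratio-below : B * D (suc n) m < A * D n m
    ratio-below = *-cancelˡ-< (Q ^ m) (B * D (suc n) m) (A * D n m) (begin-strict
      Q ^ m * (B * D (suc n) m)           ≡⟨ cong (λ z → Q ^ m * (B * z)) Dₙ₊₁≡S+T ⟩
      Q ^ m * (B * (S + T))               ≡⟨ alg₁ (Q ^ m) B S T ⟩
      B * (Q ^ m * S) + B * Q ^ m * T     ≤⟨ +-monoˡ-≤ (B * Q ^ m * T) (*-monoʳ-≤ B head-grows) ⟩
      B * (P ^ m * D n m) + B * Q ^ m * T <⟨ +-monoʳ-< (B * (P ^ m * D n m)) BQᵐT<Dₙ ⟩
      B * (P ^ m * D n m) + D n m         ≡⟨ alg₂ B (P ^ m) (D n m) ⟩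
      suc (B * P ^ m) * D n m             ≤⟨ *-monoˡ-≤ (D n m) BPᵐ<AQᵐ ⟩
      A * Q ^ m * D n m                   ≡⟨ alg₃ A (Q ^ m) (D n m) ⟩
      Q ^ m * (A * D n m)                 ∎)
      where
      alg₁ : ∀ q B S T → q * (B * (S + T)) ≡ B * (q * S) + B * q * T
      alg₁ = solve-∀
      alg₂ : ∀ B p D → B * (p * D) + D ≡ suc (B * p) * D
      alg₂ = solve-∀
      alg₃ : ∀ A q D → A * q * D ≡ q * (A * D)
      alg₃ = solve-∀

  upper-bound : ∃[ N ] (∀ n → N ≤ n → B * D (suc n) m < A * D n m)
  upper-bound = N , AtLevel.ratio-below

-- L_{t+1} = F_{t+1} + 2F_t, so φ^{t+1} = (F_{t+1}√5 + L_{t+1})/2 is also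
-- F_{t+1}·(√5+1)/2 + F_t, matching the expansions below; and F_{t+1} ≥ 1.
lucas≡fib+2fib : ∀ t → lucas (suc t) ≡ fib (suc t) + 2 * fib t
lucas≡fib+2fib zero = refl
lucas≡fib+2fib (suc zero) = refl
lucas≡fib+2fib (suc (suc t)) =
  trans (cong₂ _+_ (lucas≡fib+2fib (suc t)) (lucas≡fib+2fib t)) (alg (fib (suc t)) (fib t))
  where
  alg : ∀ a b → a + b + 2 * a + (a + 2 * b) ≡ a + b + a + 2 * (a + b)
  alg = solve-∀

fib-pos : ∀ t → 1 ≤ fib (suc t)
fib-pos zero = s≤s z≤n
fib-pos (suc t) = ≤-trans (fib-pos t) (m≤m+n _ _)

-- If P/Q nearly solves x² = x + 1, then P^{t+1} ≈ Q^t·(F_{t+1}·P + F_t·Q),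
-- the error being powErr P Q t.
powErr : ℕ → ℕ → ℕ → ℕ
powErr P Q zero = 0
powErr P Q (suc t) = fib (suc t) * Q ^ t + P * powErr P Q t

pow-expansion-below : ∀ P Q → P * P + 1 ≡ P * Q + Q * Q → ∀ t →
  P ^ suc t + powErr P Q t ≡ Q ^ t * (fib (suc t) * P + fib t * Q)
pow-expansion-below P Q near zero = alg P Q
  where
  alg : ∀ P Q → P * 1 + 0 ≡ 1 * (1 * P + 0 * Q)
  alg = solve-∀
pow-expansion-below P Q near (suc t) = begin
  P * P ^ suc t + (F * Q ^ t + P * powErr P Q t) ≡⟨ alg₁ P (P ^ suc t) F (Q ^ t) (powErr P Q t) ⟩
  P * (P ^ suc t + powErr P Q t) + F * Q ^ t     ≡⟨ cong (λ z → P * z + F * Q ^ t) (pow-expansion-below P Q near t) ⟩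
  P * (Q ^ t * (F * P + G * Q)) + F * Q ^ t      ≡⟨ alg₂ P (Q ^ t) F G Q ⟩
  Q ^ t * (F * (P * P + 1) + G * P * Q)          ≡⟨ cong (λ z → Q ^ t * (F * z + G * P * Q)) near ⟩
  Q ^ t * (F * (P * Q + Q * Q) + G * P * Q)      ≡⟨ alg₃ P (Q ^ t) F G Q ⟩
  Q * Q ^ t * ((F + G) * P + F * Q)              ∎
  where
  open ≡-Reasoning
  F G : ℕ
  F = fib (suc t)
  G = fib t
  alg₁ : ∀ P X F q S → P * X + (F * q + P * S) ≡ P * (X + S) + F * q
  alg₁ = solve-∀
  alg₂ : ∀ P q F G Q → P * (q * (F * P + G * Q)) + F * q ≡ q * (F * (P * P + 1) + G * P * Q)
  alg₂ = solve-∀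
  alg₃ : ∀ P q F G Q → q * (F * (P * Q + Q * Q) + G * P * Q) ≡ Q * q * ((F + G) * P + F * Q)
  alg₃ = solve-∀

pow-expansion-above : ∀ P Q → P * P ≡ P * Q + Q * Q + 1 → ∀ t →
  P ^ suc t ≡ Q ^ t * (fib (suc t) * P + fib t * Q) + powErr P Q t
pow-expansion-above P Q near zero = alg P Q
  where
  alg : ∀ P Q → P * 1 ≡ 1 * (1 * P + 0 * Q) + 0
  alg = solve-∀
pow-expansion-above P Q near (suc t) = begin
  P * P ^ suc t                                             ≡⟨ cong (P *_) (pow-expansion-above P Q near t) ⟩
  P * (Q ^ t * (F * P + G * Q) + powErr P Q t)              ≡⟨ alg₁ P (Q ^ t) F G Q (powErr P Q t) ⟩
  Q ^ t * (F * (P * P) + G * P * Q) + P * powErr P Q t      ≡⟨ cong (λ z → Q ^ t * (F * z + G * P * Q) + P * powErr P Q t) near ⟩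
  Q ^ t * (F * (P * Q + Q * Q + 1) + G * P * Q) + P * powErr P Q t ≡⟨ alg₂ P (Q ^ t) F G Q (powErr P Q t) ⟩
  Q * Q ^ t * ((F + G) * P + F * Q) + (F * Q ^ t + P * powErr P Q t) ∎
  where
  open ≡-Reasoning
  F G : ℕ
  F = fib (suc t)
  G = fib t
  alg₁ : ∀ P q F G Q S → P * (q * (F * P + G * Q) + S) ≡ q * (F * (P * P) + G * P * Q) + P * S
  alg₁ = solve-∀
  alg₂ : ∀ P q F G Q S → q * (F * (P * Q + Q * Q + 1) + G * P * Q) + P * S ≡ Q * q * ((F + G) * P + F * Q) + (F * q + P * S)
  alg₂ = solve-∀

errConst : ℕ → ℕ
errConst zero = 0
errConst (suc t) = fib (suc t) + 2 * errConst t

powErr-bound : ∀ P Q → P ≤ 2 * Q → ∀ t → Q * Q * powErr P Q t ≤ errConst t * Q ^ suc t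
powErr-bound P Q P≤2Q zero = subst (_≤ 0) (sym (*-zeroʳ (Q * Q))) z≤n
powErr-bound P Q P≤2Q (suc t) = begin
  Q * Q * (F * Q ^ t + P * powErr P Q t)                    ≡⟨ alg₁ Q F (Q ^ t) P (powErr P Q t) ⟩
  F * (Q * (Q * Q ^ t)) + P * (Q * Q * powErr P Q t)        ≤⟨ +-monoʳ-≤ (F * (Q * (Q * Q ^ t))) (*-mono-≤ P≤2Q (powErr-bound P Q P≤2Q t)) ⟩
  F * (Q * (Q * Q ^ t)) + 2 * Q * (errConst t * (Q * Q ^ t)) ≡⟨ alg₂ Q F (Q ^ t) (errConst t) ⟩
  (F + 2 * errConst t) * (Q * (Q * Q ^ t))                  ∎
  where
  open ≤-Reasoning
  F : ℕ
  F = fib (suc t)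
  alg₁ : ∀ Q F q P S → Q * Q * (F * q + P * S) ≡ F * (Q * (Q * q)) + P * (Q * Q * S)
  alg₁ = solve-∀
  alg₂ : ∀ Q F q c → F * (Q * (Q * q)) + 2 * Q * (c * (Q * q)) ≡ (F + 2 * c) * (Q * (Q * q))
  alg₂ = solve-∀

-- Approximants of φ: iterating (e, Q) ↦ (Q + e, 2Q + e) runs through pairs of
-- Fibonacci numbers, and P/Q = (Q+e)/Q tends to φ.  The step preserves
-- e(Q+e) − Q², as this identity shows:
approx-step : ℕ × ℕ → ℕ × ℕ
approx-step (e , Q) = (Q + e , Q + (Q + e))

approximants : ℕ × ℕ → ℕ → ℕ × ℕ
approximants start zero = start
approximants start (suc i) = approx-step (approximants start i)

approx-step-identity : ∀ e Q →
  (Q + e) * ((Q + (Q + e)) + (Q + e)) + Q * Q ≡ (Q + (Q + e)) * (Q + (Q + e)) + e * (Q + e)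
approx-step-identity = solve-∀

approx-step-growth : ∀ e Q i → e ≤ Q → suc i ≤ Q → Q + e ≤ Q + (Q + e) × suc (suc i) ≤ Q + (Q + e)
approx-step-growth e Q i e≤Q i<Q = +-monoʳ-≤ Q (m≤n+m e Q) ,
  ≤-trans (s≤s i<Q) (subst (_≤ Q + (Q + e)) (+-comm Q 1) (+-monoʳ-≤ Q (≤-trans (≤-trans (s≤s z≤n) i<Q) (m≤m+n Q e))))

approximant-≤-2Q : ∀ Q e → e ≤ Q → Q + e ≤ 2 * Q
approximant-≤-2Q Q e e≤Q = subst (Q + e ≤_) (cong (Q +_) (sym (+-identityʳ Q))) (+-monoʳ-≤ Q e≤Q)

lower-approximants : ∀ i → let (e , Q) = approximants (0 , 1) i in
  e * (Q + e) + 1 ≡ Q * Q × e ≤ Q × suc i ≤ Q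
lower-approximants zero = refl , z≤n , s≤s z≤n
lower-approximants (suc i) with approximants (0 , 1) i | lower-approximants i
... | (e , Q) | (pell , e≤Q , i<Q) = pell′ , approx-step-growth e Q i e≤Q i<Q
  where
  pell′ : (Q + e) * ((Q + (Q + e)) + (Q + e)) + 1 ≡ (Q + (Q + e)) * (Q + (Q + e))
  pell′ = +-cancelʳ-≡ (e * (Q + e)) _ _ (begin
    (Q + e) * ((Q + (Q + e)) + (Q + e)) + 1 + e * (Q + e)   ≡⟨ +-assoc _ 1 (e * (Q + e)) ⟩
    (Q + e) * ((Q + (Q + e)) + (Q + e)) + (1 + e * (Q + e)) ≡⟨ cong ((Q + e) * ((Q + (Q + e)) + (Q + e)) +_) (trans (+-comm 1 _) pell) ⟩
    (Q + e) * ((Q + (Q + e)) + (Q + e)) + Q * Q             ≡⟨ approx-step-identity e Q ⟩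
    (Q + (Q + e)) * (Q + (Q + e)) + e * (Q + e)             ∎)
    where open ≡-Reasoning

upper-approximants : ∀ i → let (e , Q) = approximants (1 , 1) i in
  e * (Q + e) ≡ Q * Q + 1 × e ≤ Q × suc i ≤ Q
upper-approximants zero = refl , s≤s z≤n , s≤s z≤n
upper-approximants (suc i) with approximants (1 , 1) i | upper-approximants i
... | (e , Q) | (pell , e≤Q , i<Q) = pell′ , approx-step-growth e Q i e≤Q i<Q
  where
  pell′ : (Q + e) * ((Q + (Q + e)) + (Q + e)) ≡ (Q + (Q + e)) * (Q + (Q + e)) + 1
  pell′ = +-cancelʳ-≡ (Q * Q) _ _ (begin
    (Q + e) * ((Q + (Q + e)) + (Q + e)) + Q * Q ≡⟨ approx-step-identity e Q ⟩
    (Q + (Q + e)) * (Q + (Q + e)) + e * (Q + e) ≡⟨ cong ((Q + (Q + e)) * (Q + (Q + e)) +_) pell ⟩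
    (Q + (Q + e)) * (Q + (Q + e)) + (Q * Q + 1) ≡⟨ alg _ (Q * Q) ⟩
    (Q + (Q + e)) * (Q + (Q + e)) + 1 + Q * Q   ∎)
    where
    open ≡-Reasoning
    alg : ∀ a b → a + (b + 1) ≡ a + 1 + b
    alg = solve-∀

-- A/B < φ^m = (F√5 + L)/2 in integers, where F = F_m and L = L_m:
-- either 2A < L·B, or 2A = L·B + T with T² < 5F²B².
BelowCut : ℕ → ℕ → ℕ → ℕ → Set
BelowCut L F A B = (2 * A < L * B) ⊎ (Σ ℕ λ T → 2 * A ≡ L * B + T × T * T < 5 * (F * F) * (B * B))

-- A/B > φ^m in integers: 2A = L·B + T with 5F²B² < T².
AboveCut : ℕ → ℕ → ℕ → ℕ → Set
AboveCut L F A B = Σ ℕ λ T → 2 * A ≡ L * B + T × 5 * (F * F) * (B * B) < T * T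

square-reflects-≤ : ∀ x y → x * x ≤ y * y → x ≤ y
square-reflects-≤ x y h with x ≤? y
... | yes x≤y = x≤y
... | no x≰y = ⊥-elim (<⇒≱ (*-mono-< (≰⇒> x≰y) (≰⇒> x≰y)) h)

≤-square : ∀ Q Z → Z ≤ Q → Z ≤ Q * Q
≤-square zero Z h = h
≤-square (suc Q) Z h = ≤-trans h (m≤m*n (suc Q) (suc Q))

-- For R = Q + 2e:  R² + 4 = 5Q² at a lower approximant, R² = 5Q² + 4 at an
-- upper one; so R/Q approximates √5 from below, respectively from above.
R²-lower : ∀ e Q → e * (Q + e) + 1 ≡ Q * Q → (Q + 2 * e) * (Q + 2 * e) + 4 ≡ 5 * (Q * Q)
R²-lower e Q pell = trans (alg₁ e Q) (trans (cong (λ z → Q * Q + 4 * z) pell) (alg₂ Q))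
  where
  alg₁ : ∀ e Q → (Q + 2 * e) * (Q + 2 * e) + 4 ≡ Q * Q + 4 * (e * (Q + e) + 1)
  alg₁ = solve-∀
  alg₂ : ∀ Q → Q * Q + 4 * (Q * Q) ≡ 5 * (Q * Q)
  alg₂ = solve-∀

R²-upper : ∀ e Q → e * (Q + e) ≡ Q * Q + 1 → (Q + 2 * e) * (Q + 2 * e) ≡ 5 * (Q * Q) + 4
R²-upper e Q pell = trans (alg₁ e Q) (trans (cong (λ z → Q * Q + 4 * z) pell) (alg₂ Q))
  where
  alg₁ : ∀ e Q → (Q + 2 * e) * (Q + 2 * e) ≡ Q * Q + 4 * (e * (Q + e))
  alg₁ = solve-∀
  alg₂ : ∀ Q → Q * Q + 4 * (Q * Q + 1) ≡ 5 * (Q * Q) + 4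
  alg₂ = solve-∀

error-small : ∀ a b K₀ Q → 1 ≤ K₀ → a + b + K₀ * K₀ ≤ Q → a * (Q * Q) + b * (Q * Q) + K₀ * K₀ ≤ (Q * Q) * (Q * Q)
error-small a b K₀ Q K₀≥1 Q-large = begin
  a * qq + b * qq + K₀ * K₀      ≤⟨ +-monoʳ-≤ _ (subst (_≤ K₀ * K₀ * qq) (*-identityʳ _) (*-monoʳ-≤ (K₀ * K₀) qq≥1)) ⟩
  a * qq + b * qq + K₀ * K₀ * qq ≡⟨ collect a b (K₀ * K₀) qq ⟩
  (a + b + K₀ * K₀) * qq         ≤⟨ *-monoˡ-≤ qq (≤-square Q _ Q-large) ⟩
  qq * qq                        ∎
  where
  open ≤-Reasoning
  qq : ℕ
  qq = Q * Q
  qq≥1 : 1 ≤ qq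
  qq≥1 = ≤-trans (≤-trans (*-mono-≤ K₀≥1 K₀≥1) (m≤n+m (K₀ * K₀) _)) (≤-square Q _ Q-large)
  collect : ∀ a b c q → a * q + b * q + c * q ≡ (a + b + c) * q
  collect = solve-∀

-- Below a lower approximant: if T² < 5F²B² then T·Q² + K₀ ≤ B·Q·F·R for Q
-- large, by comparing squares with R² = 5Q² − 4.
below-square-comparison : ∀ F B K₀ e Q T → e * (Q + e) + 1 ≡ Q * Q → 1 ≤ K₀ →
  T * T < 5 * (F * F) * (B * B) → 4 * (B * B * (F * F)) + 2 * T * K₀ + K₀ * K₀ ≤ Q →
  T * (Q * Q) + K₀ ≤ B * Q * F * (Q + 2 * e)
below-square-comparison F B K₀ e Q T pell K₀≥1 T²< Q-large =
  square-reflects-≤ Y X (+-cancelʳ-≤ (4 * (B * B * (F * F)) * qq) _ _ (begin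
    Y * Y + 4 * (B * B * (F * F)) * qq                    ≡⟨ alg₁ T qq K₀ (4 * (B * B * (F * F))) ⟩
    T * T * (qq * qq) + (4 * (B * B * (F * F)) * qq + 2 * T * K₀ * qq + K₀ * K₀)
                                                          ≤⟨ +-monoʳ-≤ _ (error-small (4 * (B * B * (F * F))) (2 * T * K₀) K₀ Q K₀≥1 Q-large) ⟩
    T * T * (qq * qq) + qq * qq                           ≡⟨ alg₂ (T * T) (qq * qq) ⟩
    (T * T + 1) * (qq * qq)                               ≤⟨ *-monoˡ-≤ (qq * qq) (subst (_≤ 5 * (F * F) * (B * B)) (+-comm 1 _) T²<) ⟩
    5 * (F * F) * (B * B) * (qq * qq)                     ≡⟨ alg₃ F B qq ⟩
    F * F * (B * B) * ((5 * qq) * qq)                     ≡⟨ cong (λ z → F * F * (B * B) * (z * qq)) (R²-lower e Q pell) ⟨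
    F * F * (B * B) * ((R * R + 4) * qq)                  ≡⟨ alg₄ F B R Q ⟩
    X * X + 4 * (B * B * (F * F)) * qq                    ∎))
  where
  open ≤-Reasoning
  R qq X Y : ℕ
  R = Q + 2 * e
  qq = Q * Q
  X = B * Q * F * R
  Y = T * qq + K₀
  alg₁ : ∀ T q k a → (T * q + k) * (T * q + k) + a * q ≡ T * T * (q * q) + (a * q + 2 * T * k * q + k * k)
  alg₁ = solve-∀
  alg₂ : ∀ a b → a * b + b ≡ (a + 1) * b
  alg₂ = solve-∀
  alg₃ : ∀ F B q → 5 * (F * F) * (B * B) * (q * q) ≡ F * F * (B * B) * ((5 * q) * q)
  alg₃ = solve-∀
  alg₄ : ∀ F B R Q → F * F * (B * B) * ((R * R + 4) * (Q * Q)) ≡ (B * Q * F * R) * (B * Q * F * R) + 4 * (B * B * (F * F)) * (Q * Q)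
  alg₄ = solve-∀

-- Above an upper approximant: if 5F²B² < T² then B·Q·F·R + K₀ ≤ T·Q² for Q
-- large, by comparing squares with R² = 5Q² + 4 (and R ≤ 3Q).
above-square-comparison : ∀ F B K₀ e Q T → e * (Q + e) ≡ Q * Q + 1 → e ≤ Q → 1 ≤ K₀ →
  5 * (F * F) * (B * B) < T * T → 4 * (B * B * (F * F)) + 6 * B * F * K₀ + K₀ * K₀ ≤ Q →
  B * Q * F * (Q + 2 * e) + K₀ ≤ T * (Q * Q)
above-square-comparison F B K₀ e Q T pell e≤Q K₀≥1 T²> Q-large = square-reflects-≤ Y (T * qq) (begin
  Y * Y                                                               ≡⟨ alg₁ B Q F R K₀ ⟩
  F * F * (B * B) * (qq * (R * R)) + 2 * X * K₀ + K₀ * K₀             ≡⟨ cong (λ z → F * F * (B * B) * (qq * z) + 2 * X * K₀ + K₀ * K₀) (R²-upper e Q pell) ⟩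
  F * F * (B * B) * (qq * (5 * qq + 4)) + 2 * X * K₀ + K₀ * K₀        ≤⟨ +-monoˡ-≤ (K₀ * K₀) (+-monoʳ-≤ _ (*-monoˡ-≤ K₀ (*-monoʳ-≤ 2 X≤3BFQ²))) ⟩
  F * F * (B * B) * (qq * (5 * qq + 4)) + 2 * (3 * B * F * qq) * K₀ + K₀ * K₀
                                                                      ≡⟨ alg₂ F B qq K₀ ⟩
  5 * (F * F) * (B * B) * (qq * qq) + (4 * (B * B * (F * F)) * qq + 6 * B * F * K₀ * qq + K₀ * K₀)
                                                                      ≤⟨ +-monoʳ-≤ _ (error-small (4 * (B * B * (F * F))) (6 * B * F * K₀) K₀ Q K₀≥1 Q-large) ⟩
  5 * (F * F) * (B * B) * (qq * qq) + qq * qq                         ≡⟨ alg₃ (5 * (F * F) * (B * B)) (qq * qq) ⟩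
  suc (5 * (F * F) * (B * B)) * (qq * qq)                             ≤⟨ *-monoˡ-≤ (qq * qq) T²> ⟩
  T * T * (qq * qq)                                                   ≡⟨ alg₄ T qq ⟩
  (T * qq) * (T * qq)                                                 ∎)
  where
  open ≤-Reasoning
  R qq X Y : ℕ
  R = Q + 2 * e
  qq = Q * Q
  X = B * Q * F * R
  Y = X + K₀
  X≤3BFQ² : X ≤ 3 * B * F * qq
  X≤3BFQ² = begin
    B * Q * F * R            ≤⟨ *-monoʳ-≤ (B * Q * F) (+-monoʳ-≤ Q (*-monoʳ-≤ 2 e≤Q)) ⟩
    B * Q * F * (Q + 2 * Q)  ≡⟨ alg B Q F ⟩
    3 * B * F * qq           ∎
    where
    alg : ∀ B Q F → B * Q * F * (Q + 2 * Q) ≡ 3 * B * F * (Q * Q)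
    alg = solve-∀
  alg₁ : ∀ B Q F R K₀ → (B * Q * F * R + K₀) * (B * Q * F * R + K₀) ≡ F * F * (B * B) * ((Q * Q) * (R * R)) + 2 * (B * Q * F * R) * K₀ + K₀ * K₀
  alg₁ = solve-∀
  alg₂ : ∀ F B q K₀ → F * F * (B * B) * (q * (5 * q + 4)) + 2 * (3 * B * F * q) * K₀ + K₀ * K₀ ≡ 5 * (F * F) * (B * B) * (q * q) + (4 * (B * B * (F * F)) * q + 6 * B * F * K₀ * q + K₀ * K₀)
  alg₂ = solve-∀
  alg₃ : ∀ a b → a * b + b ≡ suc a * b
  alg₃ = solve-∀
  alg₄ : ∀ T q → T * T * (q * q) ≡ (T * q) * (T * q)
  alg₄ = solve-∀

allowance : ℕ → ℕ → ℕ
allowance B c = 2 * B * c + 2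

allowance-pos : ∀ B c → 1 ≤ allowance B c
allowance-pos B c = ≤-trans (s≤s z≤n) (m≤n+m 2 (2 * B * c))

below-threshold : ∀ L F A B c → BelowCut L F A B → ℕ
below-threshold L F A B c (inj₁ _) = 2 * c + 2
below-threshold L F A B c (inj₂ (T , _)) = 4 * (B * B * (F * F)) + 2 * T * allowance B c + allowance B c * allowance B c

-- The key comparison for a lower approximant P = Q + e with Q large:
-- A/B < (F√5 + L)/2 with L = F + 2G leaves room for an error term B·c.
core-below : ∀ F G A B c e Q → e * (Q + e) + 1 ≡ Q * Q → 1 ≤ F → 1 ≤ B →
  (cut : BelowCut (F + 2 * G) F A B) → below-threshold (F + 2 * G) F A B c cut ≤ Q →
  A * (Q * Q) + B * c < B * (Q * (F * (Q + e) + G * Q))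
core-below F G A B c e Q pell F≥1 B≥1 cut Q-large = *-cancelˡ-≤ 2 (begin
  2 * suc (A * (Q * Q) + B * c)             ≡⟨ double-lhs A Q B c ⟩
  2 * A * (Q * Q) + K₀                      ≤⟨ separated cut Q-large ⟩
  X + (F + 2 * G) * B * (Q * Q)             ≡⟨ double-rhs B Q F e G ⟩
  2 * (B * (Q * (F * (Q + e) + G * Q)))     ∎)
  where
  open ≤-Reasoning
  K₀ X : ℕ
  K₀ = allowance B c
  X = B * Q * F * (Q + 2 * e)
  double-lhs : ∀ A Q B c → 2 * suc (A * (Q * Q) + B * c) ≡ 2 * A * (Q * Q) + (2 * B * c + 2)
  double-lhs = solve-∀
  double-rhs : ∀ B Q F e G → B * Q * F * (Q + 2 * e) + (F + 2 * G) * B * (Q * Q) ≡ 2 * (B * (Q * (F * (Q + e) + G * Q)))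
  double-rhs = solve-∀
  separated : (cut : BelowCut (F + 2 * G) F A B) → below-threshold (F + 2 * G) F A B c cut ≤ Q →
    2 * A * (Q * Q) + K₀ ≤ X + (F + 2 * G) * B * (Q * Q)
  -- 2A < L·B: the allowance is absorbed by X ≥ B·Q ≥ K₀
  separated (inj₁ 2A<LB) Q-large = begin
    2 * A * (Q * Q) + K₀           ≡⟨ +-comm _ K₀ ⟩
    K₀ + 2 * A * (Q * Q)           ≤⟨ +-mono-≤ K₀≤X (*-monoˡ-≤ (Q * Q) (<⇒≤ 2A<LB)) ⟩
    X + (F + 2 * G) * B * (Q * Q)  ∎
    where
    K₀≤X : K₀ ≤ X
    K₀≤X = begin
      2 * B * c + 2     ≤⟨ +-monoʳ-≤ (2 * B * c) (*-monoʳ-≤ 2 B≥1) ⟩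
      2 * B * c + 2 * B ≡⟨ alg B c ⟩
      B * (2 * c + 2)   ≤⟨ *-monoʳ-≤ B Q-large ⟩
      B * Q             ≡⟨ *-identityʳ (B * Q) ⟨
      B * Q * 1         ≤⟨ *-monoʳ-≤ (B * Q) F≥1 ⟩
      B * Q * F         ≡⟨ *-identityʳ (B * Q * F) ⟨
      B * Q * F * 1     ≤⟨ *-monoʳ-≤ (B * Q * F) (≤-trans (≤-trans (≤-trans (s≤s z≤n) (m≤n+m 2 (2 * c))) Q-large) (m≤m+n Q _)) ⟩
      X                 ∎
      where
      alg : ∀ B c → 2 * B * c + 2 * B ≡ B * (2 * c + 2)
      alg = solve-∀
  separated (inj₂ (T , 2A≡ , T²<)) Q-large = begin
    2 * A * (Q * Q) + K₀                      ≡⟨ cong (λ z → z * (Q * Q) + K₀) 2A≡ ⟩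
    ((F + 2 * G) * B + T) * (Q * Q) + K₀      ≡⟨ alg ((F + 2 * G) * B) T (Q * Q) K₀ ⟩
    (F + 2 * G) * B * (Q * Q) + (T * (Q * Q) + K₀) ≤⟨ +-monoʳ-≤ _ (below-square-comparison F B K₀ e Q T pell (allowance-pos B c) T²< Q-large) ⟩
    (F + 2 * G) * B * (Q * Q) + X             ≡⟨ +-comm _ X ⟩
    X + (F + 2 * G) * B * (Q * Q)             ∎
    where
    alg : ∀ a T q k → (a + T) * q + k ≡ a * q + (T * q + k)
    alg = solve-∀

above-threshold : ℕ → ℕ → ℕ → ℕ
above-threshold F B c = 4 * (B * B * (F * F)) + 6 * B * F * allowance B c + allowance B c * allowance B c

-- The key comparison for an upper approximant: A/B > (F√5 + L)/2 leaves room
-- for the error term B·c.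
core-above : ∀ F G A B c e Q → e * (Q + e) ≡ Q * Q + 1 → e ≤ Q →
  AboveCut (F + 2 * G) F A B → above-threshold F B c ≤ Q →
  B * (Q * (F * (Q + e) + G * Q)) + B * c < A * (Q * Q)
core-above F G A B c e Q pell e≤Q (T , 2A≡ , T²>) Q-large = *-cancelˡ-≤ 2 (begin
  2 * suc (B * (Q * (F * (Q + e) + G * Q)) + B * c)       ≡⟨ double-lhs B Q F e G c ⟩
  (F + 2 * G) * B * (Q * Q) + (B * Q * F * (Q + 2 * e) + allowance B c)
      ≤⟨ +-monoʳ-≤ _ (above-square-comparison F B (allowance B c) e Q T pell e≤Q (allowance-pos B c) T²> Q-large) ⟩
  (F + 2 * G) * B * (Q * Q) + T * (Q * Q)                 ≡⟨ collect ((F + 2 * G) * B) T (Q * Q) ⟩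
  ((F + 2 * G) * B + T) * (Q * Q)                         ≡⟨ cong (_* (Q * Q)) (sym 2A≡) ⟩
  2 * A * (Q * Q)                                         ≡⟨ *-assoc 2 A (Q * Q) ⟩
  2 * (A * (Q * Q))                                       ∎)
  where
  open ≤-Reasoning
  double-lhs : ∀ B Q F e G c → 2 * suc (B * (Q * (F * (Q + e) + G * Q)) + B * c) ≡ (F + 2 * G) * B * (Q * Q) + (B * Q * F * (Q + 2 * e) + (2 * B * c + 2))
  double-lhs = solve-∀
  collect : ∀ a T q → a * q + T * q ≡ (a + T) * q
  collect = solve-∀

power-comparison-below : ∀ t A B c P Q W S → 1 ≤ Q → P ^ suc t + S ≡ Q ^ t * W →
  Q * Q * S ≤ c * Q ^ suc t → A * (Q * Q) + B * c < B * (Q * W) → A * Q ^ suc t < B * P ^ suc t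
power-comparison-below t A B c P Q W S Q≥1 expansion S-small core = *-cancelˡ-< (Q * Q) _ _ (begin-strict
  Q * Q * (A * Q ^ m)         <⟨ subst (_< Q * Q * (A * Q ^ m) + Q ^ m) (+-identityʳ _) (+-monoʳ-< (Q * Q * (A * Q ^ m)) Qᵐ≥1) ⟩
  Q * Q * (A * Q ^ m) + Q ^ m ≤⟨ +-cancelʳ-≤ (B * c * Q ^ m) _ _ (subst (_≤ B * (Q * Q * P ^ m) + B * c * Q ^ m) (swap (Q * Q * (A * Q ^ m)) (B * c * Q ^ m) (Q ^ m)) scaled) ⟩
  B * (Q * Q * P ^ m)         ≡⟨ regroup B (Q * Q) (P ^ m) ⟩
  Q * Q * (B * P ^ m)         ∎)
  where
  open ≤-Reasoning
  m : ℕ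
  m = suc t
  Qᵐ≥1 : 1 ≤ Q ^ m
  Qᵐ≥1 = subst (_≤ Q ^ m) (^-zeroˡ m) (^-monoˡ-≤ m Q≥1)
  scaled : Q * Q * (A * Q ^ m) + B * c * Q ^ m + Q ^ m ≤ B * (Q * Q * P ^ m) + B * c * Q ^ m
  scaled = begin
    Q * Q * (A * Q ^ m) + B * c * Q ^ m + Q ^ m ≡⟨ alg₁ Q A (Q ^ m) B c ⟩
    Q ^ m * suc (A * (Q * Q) + B * c)           ≤⟨ *-monoʳ-≤ (Q ^ m) core ⟩
    Q ^ m * (B * (Q * W))                       ≡⟨ alg₂ Q (Q ^ t) B W ⟩
    B * (Q * Q) * (Q ^ t * W)                   ≡⟨ cong (B * (Q * Q) *_) expansion ⟨
    B * (Q * Q) * (P ^ m + S)                   ≡⟨ alg₃ B Q (P ^ m) S ⟩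
    B * (Q * Q * P ^ m) + B * (Q * Q * S)       ≤⟨ +-monoʳ-≤ _ (subst (B * (Q * Q * S) ≤_) (sym (*-assoc B c (Q ^ m))) (*-monoʳ-≤ B S-small)) ⟩
    B * (Q * Q * P ^ m) + B * c * Q ^ m         ∎
    where
    alg₁ : ∀ Q A q B c → Q * Q * (A * q) + B * c * q + q ≡ q * suc (A * (Q * Q) + B * c)
    alg₁ = solve-∀
    alg₂ : ∀ Q q B W → Q * q * (B * (Q * W)) ≡ B * (Q * Q) * (q * W)
    alg₂ = solve-∀
    alg₃ : ∀ B Q p S → B * (Q * Q) * (p + S) ≡ B * (Q * Q * p) + B * (Q * Q * S)
    alg₃ = solve-∀
  swap : ∀ a b q → a + b + q ≡ a + q + b
  swap = solve-∀
  regroup : ∀ B q p → B * (q * p) ≡ q * (B * p)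
  regroup = solve-∀

power-comparison-above : ∀ t A B c P Q W S → 1 ≤ Q → P ^ suc t ≡ Q ^ t * W + S →
  Q * Q * S ≤ c * Q ^ suc t → B * (Q * W) + B * c < A * (Q * Q) → B * P ^ suc t < A * Q ^ suc t
power-comparison-above t A B c P Q W S Q≥1 expansion S-small core = *-cancelˡ-< (Q * Q) _ _ (begin-strict
  Q * Q * (B * P ^ m)                     ≡⟨ cong (λ z → Q * Q * (B * z)) expansion ⟩
  Q * Q * (B * (Q ^ t * W + S))           ≡⟨ alg₁ Q B (Q ^ t) W S ⟩
  Q ^ m * (B * (Q * W)) + B * (Q * Q * S) ≤⟨ +-monoʳ-≤ _ (*-monoʳ-≤ B S-small) ⟩
  Q ^ m * (B * (Q * W)) + B * (c * Q ^ m) ≡⟨ alg₂ (Q ^ m) B (Q * W) c ⟩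
  Q ^ m * (B * (Q * W) + B * c)           <⟨ *-monoʳ-< (Q ^ m) {{Qᵐ≢0}} core ⟩
  Q ^ m * (A * (Q * Q))                   ≡⟨ alg₃ (Q ^ m) A (Q * Q) ⟩
  Q * Q * (A * Q ^ m)                     ∎)
  where
  open ≤-Reasoning
  m : ℕ
  m = suc t
  Qᵐ≢0 : NonZero (Q ^ m)
  Qᵐ≢0 = >-nonZero (subst (_≤ Q ^ m) (^-zeroˡ m) (^-monoˡ-≤ m Q≥1))
  alg₁ : ∀ Q B q W S → Q * Q * (B * (q * W + S)) ≡ Q * q * (B * (Q * W)) + B * (Q * Q * S)
  alg₁ = solve-∀
  alg₂ : ∀ q B X c → q * (B * X) + B * (c * q) ≡ q * (B * X + B * c)
  alg₂ = solve-∀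
  alg₃ : ∀ q A x → q * (A * x) ≡ x * (A * q)
  alg₃ = solve-∀

-- If A/B < φ^m (m = t + 1), then A·D_n < B·D_{n+1} for all large n: choose a
-- lower approximant P/Q so fine that still A·Q^m < B·P^m, and apply LowerBound.
lower-from-cut : ∀ t A B → 1 ≤ B → BelowCut (lucas (suc t)) (fib (suc t)) A B →
  ∃[ N ] (∀ n → N ≤ n → A * D n (suc t) < B * D (suc n) (suc t))
lower-from-cut t A B B≥1 cut = LowerBound.lower-bound Q e t A B pell Q≥1 AQᵐ<BPᵐ
  where
  F G c : ℕ
  F = fib (suc t)
  G = fib t
  c = errConst t
  cut′ : BelowCut (F + 2 * G) F A B
  cut′ = subst (λ L → BelowCut L F A B) (lucas≡fib+2fib t) cut
  i e Q P W : ℕ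
  i = below-threshold (F + 2 * G) F A B c cut′
  e = proj₁ (approximants (0 , 1) i)
  Q = proj₂ (approximants (0 , 1) i)
  P = Q + e
  W = F * P + G * Q
  pell : e * (Q + e) + 1 ≡ Q * Q
  pell = proj₁ (lower-approximants i)
  e≤Q : e ≤ Q
  e≤Q = proj₁ (proj₂ (lower-approximants i))
  i<Q : suc i ≤ Q
  i<Q = proj₂ (proj₂ (lower-approximants i))
  Q≥1 : 1 ≤ Q
  Q≥1 = ≤-trans (s≤s z≤n) i<Q
  core : A * (Q * Q) + B * c < B * (Q * W)
  core = core-below F G A B c e Q pell (fib-pos t) B≥1 cut′ (<⇒≤ i<Q)
  near-root : P * P + 1 ≡ P * Q + Q * Q
  near-root = trans (alg Q e) (cong ((Q + e) * Q +_) pell)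
    where
    alg : ∀ Q e → (Q + e) * (Q + e) + 1 ≡ (Q + e) * Q + (e * (Q + e) + 1)
    alg = solve-∀
  AQᵐ<BPᵐ : A * Q ^ suc t < B * P ^ suc t
  AQᵐ<BPᵐ = power-comparison-below t A B c P Q W (powErr P Q t) Q≥1 (pow-expansion-below P Q near-root t)
    (powErr-bound P Q (approximant-≤-2Q Q e e≤Q) t) core

upper-from-cut : ∀ t A B → 1 ≤ B → AboveCut (lucas (suc t)) (fib (suc t)) A B →
  ∃[ N ] (∀ n → N ≤ n → B * D (suc n) (suc t) < A * D n (suc t))
upper-from-cut t A B B≥1 cut = UpperBound.upper-bound Q e t A B pell Q≥1 B≥1 BPᵐ<AQᵐ
  where
  F G c i e Q P W : ℕ
  F = fib (suc t)
  G = fib t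
  c = errConst t
  i = above-threshold F B c
  e = proj₁ (approximants (1 , 1) i)
  Q = proj₂ (approximants (1 , 1) i)
  P = Q + e
  W = F * P + G * Q
  pell : e * (Q + e) ≡ Q * Q + 1
  pell = proj₁ (upper-approximants i)
  e≤Q : e ≤ Q
  e≤Q = proj₁ (proj₂ (upper-approximants i))
  i<Q : suc i ≤ Q
  i<Q = proj₂ (proj₂ (upper-approximants i))
  Q≥1 : 1 ≤ Q
  Q≥1 = ≤-trans (s≤s z≤n) i<Q
  core : B * (Q * W) + B * c < A * (Q * Q)
  core = core-above F G A B c e Q pell e≤Q (subst (λ L → AboveCut L F A B) (lucas≡fib+2fib t) cut) (<⇒≤ i<Q)
  near-root : P * P ≡ P * Q + Q * Q + 1
  near-root = trans (alg Q e) (trans (cong ((Q + e) * Q +_) pell) (sym (+-assoc _ (Q * Q) 1)))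
    where
    alg : ∀ Q e → (Q + e) * (Q + e) ≡ (Q + e) * Q + e * (Q + e)
    alg = solve-∀
  BPᵐ<AQᵐ : B * P ^ suc t < A * Q ^ suc t
  BPᵐ<AQᵐ = power-comparison-above t A B c P Q W (powErr P Q t) Q≥1 (pow-expansion-above P Q near-root t)
    (powErr-bound P Q (approximant-≤-2Q Q e e≤Q) t) core

open import Data.Integer as ℤ using (ℤ; +_; -[1+_])
import Data.Integer.Properties as ℤP
import Data.Integer.Tactic.RingSolver as ℤ-Solver
open import Data.Rational as ℚ using (ℚ; mkℚ; toℚᵘ)
import Data.Rational.Properties as ℚP
open import Data.Rational.Unnormalised as ℚᵘ using (ℚᵘ; mkℚᵘ; *≡*; *<*)
import Data.Rational.Unnormalised.Properties as ℚᵘP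

-- The cuts BelowTarget / AboveTarget of φ^m are stated in ℚ; we read them as
-- integer inequalities about numerator and denominator, passing through the
-- unnormalised rationals where arithmetic is computed without reduction.

natᵘ : ℕ → ℚᵘ
natᵘ k = mkℚᵘ (+ k) 0

toℚᵘ-ℕ→ℚ : ∀ k → toℚᵘ (ℕ→ℚ k) ℚᵘ.≃ natᵘ k
toℚᵘ-ℕ→ℚ k = ℚP.toℚᵘ-fromℚᵘ (natᵘ k)

toℚᵘ-homo-− : ∀ x y → toℚᵘ (x ℚ.- y) ℚᵘ.≃ toℚᵘ x ℚᵘ.- toℚᵘ y
toℚᵘ-homo-− x y = ℚᵘP.≃-trans (ℚP.toℚᵘ-homo-+ x (ℚ.- y)) (ℚᵘP.+-cong (ℚᵘP.≃-refl {toℚᵘ x}) (ℚP.toℚᵘ-homo‿- y))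

toℚᵘ-components : ∀ a → toℚᵘ a ℚᵘ.≃ mkℚᵘ (ℚ.numerator a) (ℚ.denominator-1 a)
toℚᵘ-components (mkℚ p d c) = ℚᵘP.≃-refl

-- For a = p/(d+1), the quantity 2a − L equals gap L p d / (d+1).
gap : ℕ → ℤ → ℕ → ℤ
gap L p d = (+ 2) ℤ.* p ℤ.- (+ L) ℤ.* (+ suc d)

gap-fraction : ∀ p d L → (natᵘ 2 ℚᵘ.* mkℚᵘ p d) ℚᵘ.- natᵘ L ℚᵘ.≃ mkℚᵘ (gap L p d) d
gap-fraction p d L = *≡* (subst (λ z → ((+ 2 ℤ.* p) ℤ.* + 1 ℤ.+ (ℤ.- (+ L)) ℤ.* + suc z) ℤ.* + suc d ≡ gap L p d ℤ.* + suc (z * 1)) (sym (+-identityʳ d))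
  (subst (λ z → ((+ 2 ℤ.* p) ℤ.* + 1 ℤ.+ (ℤ.- (+ L)) ℤ.* + suc d) ℤ.* + suc d ≡ gap L p d ℤ.* + suc z) (sym (*-identityʳ d))
    (alg (+ 2 ℤ.* p) (+ L) (+ suc d))))
  where
  alg : ∀ (P L D : ℤ) → (P ℤ.* + 1 ℤ.+ (ℤ.- L) ℤ.* D) ℤ.* D ≡ (P ℤ.- L ℤ.* D) ℤ.* D
  alg = ℤ-Solver.solve-∀

toℚᵘ-gap : ∀ L a → toℚᵘ ((ℕ→ℚ 2 ℚ.* a) ℚ.- ℕ→ℚ L) ℚᵘ.≃ mkℚᵘ (gap L (ℚ.numerator a) (ℚ.denominator-1 a)) (ℚ.denominator-1 a)
toℚᵘ-gap L a = ℚᵘP.≃-trans (toℚᵘ-homo-− (ℕ→ℚ 2 ℚ.* a) (ℕ→ℚ L))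
  (ℚᵘP.≃-trans (ℚᵘP.+-cong (ℚᵘP.≃-trans (ℚP.toℚᵘ-homo-* (ℕ→ℚ 2) a) (ℚᵘP.*-cong (toℚᵘ-ℕ→ℚ 2) (toℚᵘ-components a)))
                           (ℚᵘP.-‿cong (toℚᵘ-ℕ→ℚ L)))
    (gap-fraction (ℚ.numerator a) (ℚ.denominator-1 a) L))

toℚᵘ-gap² : ∀ L a → let t = (ℕ→ℚ 2 ℚ.* a) ℚ.- ℕ→ℚ L ; g = mkℚᵘ (gap L (ℚ.numerator a) (ℚ.denominator-1 a)) (ℚ.denominator-1 a) in
  toℚᵘ (t ℚ.* t) ℚᵘ.≃ g ℚᵘ.* g
toℚᵘ-gap² L a = ℚᵘP.≃-trans (ℚP.toℚᵘ-homo-* t t) (ℚᵘP.*-cong (toℚᵘ-gap L a) (toℚᵘ-gap L a))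
  where
  t : ℚ
  t = (ℕ→ℚ 2 ℚ.* a) ℚ.- ℕ→ℚ L

toℚᵘ-5F² : ∀ F → toℚᵘ (ℕ→ℚ 5 ℚ.* (ℕ→ℚ F ℚ.* ℕ→ℚ F)) ℚᵘ.≃ natᵘ 5 ℚᵘ.* (natᵘ F ℚᵘ.* natᵘ F)
toℚᵘ-5F² F = ℚᵘP.≃-trans (ℚP.toℚᵘ-homo-* (ℕ→ℚ 5) (ℕ→ℚ F ℚ.* ℕ→ℚ F))
  (ℚᵘP.*-cong (toℚᵘ-ℕ→ℚ 5) (ℚᵘP.≃-trans (ℚP.toℚᵘ-homo-* (ℕ→ℚ F) (ℕ→ℚ F)) (ℚᵘP.*-cong (toℚᵘ-ℕ→ℚ F) (toℚᵘ-ℕ→ℚ F))))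

five-F² : ℕ → ℤ
five-F² F = + 5 ℤ.* (+ F ℤ.* + F)

below-target-ℤ : ∀ m a → BelowTarget m a →
  let g = gap (lucas m) (ℚ.numerator a) (ℚ.denominator-1 a) ; d = ℚ.denominator-1 a in
  (g ℤ.* + 1 ℤ.< + 0 ℤ.* + suc d) ⊎ ((g ℤ.* g) ℤ.* + 1 ℤ.< five-F² (fib m) ℤ.* + (suc d * suc d))
below-target-ℤ m a (inj₁ t<0) with ℚᵘP.<-respˡ-≃ (toℚᵘ-gap (lucas m) a) (ℚP.toℚᵘ-mono-< t<0)
... | *<* h = inj₁ h
below-target-ℤ m a (inj₂ t²<5F²) with ℚᵘP.<-respʳ-≃ (toℚᵘ-5F² (fib m)) (ℚᵘP.<-respˡ-≃ (toℚᵘ-gap² (lucas m) a) (ℚP.toℚᵘ-mono-< t²<5F²))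
... | *<* h = inj₂ h

above-target-ℤ : ∀ m a → AboveTarget m a →
  let g = gap (lucas m) (ℚ.numerator a) (ℚ.denominator-1 a) ; d = ℚ.denominator-1 a in
  (+ 0 ℤ.* + suc d ℤ.< g ℤ.* + 1) × (five-F² (fib m) ℤ.* + (suc d * suc d) ℤ.< (g ℤ.* g) ℤ.* + 1)
above-target-ℤ m a (0<t , 5F²<t²)
  with ℚᵘP.<-respʳ-≃ (toℚᵘ-gap (lucas m) a) (ℚP.toℚᵘ-mono-< 0<t)
     | ℚᵘP.<-respˡ-≃ (toℚᵘ-5F² (fib m)) (ℚᵘP.<-respʳ-≃ (toℚᵘ-gap² (lucas m) a) (ℚP.toℚᵘ-mono-< 5F²<t²))
... | *<* h₁ | *<* h₂ = h₁ , h₂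

gap-nonneg : ∀ L A d → gap L (+ A) d ≡ (2 * A) ℤ.⊖ (L * suc d)
gap-nonneg L A d = trans (cong₂ ℤ._-_ (sym (ℤP.pos-* 2 A)) (sym (ℤP.pos-* L (suc d)))) (ℤP.m-n≡m⊖n (2 * A) (L * suc d))

five-F²-pos : ∀ F B → five-F² F ℤ.* + B ≡ + (5 * (F * F) * B)
five-F²-pos F B = sym (trans (ℤP.pos-* (5 * (F * F)) B) (cong (ℤ._* + B) (trans (ℤP.pos-* 5 (F * F)) (cong (+ 5 ℤ.*_) (ℤP.pos-* F F)))))

square-pos : ∀ T → (+ T ℤ.* + T) ℤ.* + 1 ≡ + (T * T)
square-pos T = trans (ℤP.*-identityʳ _) (sym (ℤP.pos-* T T))

not-positive : ∀ x → + 0 ℤ.< ℤ.- (+ x) → ⊥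
not-positive x = ℤP.≤⇒≯ (ℤP.neg-≤-pos {x} {0})

below-cut : ∀ L F A d → let g = gap L (+ A) d in
  (g ℤ.* + 1 ℤ.< + 0 ℤ.* + suc d) ⊎ ((g ℤ.* g) ℤ.* + 1 ℤ.< five-F² F ℤ.* + (suc d * suc d)) →
  BelowCut L F A (suc d)
below-cut L F A d raw with 2 * A <? L * suc d
... | yes 2A<LB = inj₁ 2A<LB
... | no 2A≮LB = inj₂ (T , 2A≡ , square-below raw)
  where
  LB≤2A : L * suc d ≤ 2 * A
  LB≤2A = ≮⇒≥ 2A≮LB
  T : ℕ
  T = 2 * A ∸ L * suc d
  2A≡ : 2 * A ≡ L * suc d + T
  2A≡ = sym (m+[n∸m]≡n LB≤2A)
  g≡T : gap L (+ A) d ≡ + T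
  g≡T = trans (gap-nonneg L A d) (ℤP.⊖-≥ LB≤2A)
  square-below : (gap L (+ A) d ℤ.* + 1 ℤ.< + 0 ℤ.* + suc d) ⊎
                 ((gap L (+ A) d ℤ.* gap L (+ A) d) ℤ.* + 1 ℤ.< five-F² F ℤ.* + (suc d * suc d)) →
                 T * T < 5 * (F * F) * (suc d * suc d)
  square-below (inj₁ g<0) = ⊥-elim (n≮0 (ℤP.drop‿+<+ (subst₂ ℤ._<_ (trans (ℤP.*-identityʳ _) g≡T) refl g<0)))
  square-below (inj₂ g²<) = ℤP.drop‿+<+ (subst₂ ℤ._<_ (trans (cong (λ z → (z ℤ.* z) ℤ.* + 1) g≡T) (square-pos T)) (five-F²-pos F _) g²<)

above-cut : ∀ L F p d → let g = gap L p d in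
  (+ 0 ℤ.* + suc d ℤ.< g ℤ.* + 1) × (five-F² F ℤ.* + (suc d * suc d) ℤ.< (g ℤ.* g) ℤ.* + 1) →
  Σ ℕ λ A → p ≡ + A × AboveCut L F A (suc d)
above-cut L F (+ A) d (0<g , 5F²<g²) with L * suc d <? 2 * A
... | yes LB<2A = A , refl , T , 2A≡ ,
        ℤP.drop‿+<+ (subst₂ ℤ._<_ (five-F²-pos F _) (trans (cong (λ z → (z ℤ.* z) ℤ.* + 1) g≡T) (square-pos T)) 5F²<g²)
  where
  LB≤2A : L * suc d ≤ 2 * A
  LB≤2A = <⇒≤ LB<2A
  T : ℕ
  T = 2 * A ∸ L * suc d
  2A≡ : 2 * A ≡ L * suc d + T
  2A≡ = sym (m+[n∸m]≡n LB≤2A)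
  g≡T : gap L (+ A) d ≡ + T
  g≡T = trans (gap-nonneg L A d) (ℤP.⊖-≥ LB≤2A)
... | no LB≮2A = ⊥-elim (not-positive _ (subst (+ 0 ℤ.<_) g≡ 0<g))
  where
  g≡ : gap L (+ A) d ℤ.* + 1 ≡ ℤ.- (+ (L * suc d ∸ 2 * A))
  g≡ = trans (ℤP.*-identityʳ _) (trans (gap-nonneg L A d) (ℤP.⊖-≤ (≮⇒≥ LB≮2A)))
above-cut L F -[1+ k ] d (0<g , _) = ⊥-elim (not-positive _ (subst (+ 0 ℤ.<_) g≡ 0<g))
  where
  alg : ∀ (K L B : ℤ) → + 2 ℤ.* (ℤ.- K) ℤ.- L ℤ.* B ≡ ℤ.- (+ 2 ℤ.* K ℤ.+ L ℤ.* B)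
  alg = ℤ-Solver.solve-∀
  g≡ : gap L -[1+ k ] d ℤ.* + 1 ≡ ℤ.- (+ (2 * suc k + L * suc d))
  g≡ = trans (ℤP.*-identityʳ _) (trans (alg (+ suc k) (+ L) (+ suc d))
         (cong ℤ.-_ (sym (trans (ℤP.pos-+ (2 * suc k) (L * suc d)) (cong₂ ℤ._+_ (ℤP.pos-* 2 (suc k)) (ℤP.pos-* L (suc d)))))))

D-suc-pred : ∀ m n → suc (pred (D n m)) ≡ D n m
D-suc-pred m n = suc-pred (D n m) {{D-nonZero n m}}

toℚᵘ-ratio : ∀ m n → toℚᵘ (ratio m n) ℚᵘ.≃ mkℚᵘ (+ D (suc n) m) (pred (D n m))
toℚᵘ-ratio m n = ℚᵘP.≃-trans (ℚᵘP.≃-reflexive (cong toℚᵘ ratio≡)) (ℚP.toℚᵘ-fromℚᵘ (mkℚᵘ (+ D (suc n) m) (pred (D n m))))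
  where
  ratio≡ : ratio m n ≡ (+ D (suc n) m) ℚ./ suc (pred (D n m))
  ratio≡ = ℚP./-cong {p₁ = + D (suc n) m} {q₁ = D n m} {p₂ = + D (suc n) m} {q₂ = suc (pred (D n m))}
    {{D-nonZero n m}} {{_}} refl (sym (D-suc-pred m n))

below-ratio : ∀ m n a → ℚ.numerator a ℤ.* + D n m ℤ.< + D (suc n) m ℤ.* + suc (ℚ.denominator-1 a) → a ℚ.< ratio m n
below-ratio m n a h = ℚP.toℚᵘ-cancel-< (ℚᵘP.<-respʳ-≃ (ℚᵘP.≃-sym (toℚᵘ-ratio m n)) (ℚᵘP.<-respˡ-≃ (ℚᵘP.≃-sym (toℚᵘ-components a))
  (*<* (subst (λ z → ℚ.numerator a ℤ.* + z ℤ.< + D (suc n) m ℤ.* + suc (ℚ.denominator-1 a)) (sym (D-suc-pred m n)) h))))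

above-ratio : ∀ m n b → + D (suc n) m ℤ.* + suc (ℚ.denominator-1 b) ℤ.< ℚ.numerator b ℤ.* + D n m → ratio m n ℚ.< b
above-ratio m n b h = ℚP.toℚᵘ-cancel-< (ℚᵘP.<-respˡ-≃ (ℚᵘP.≃-sym (toℚᵘ-ratio m n)) (ℚᵘP.<-respʳ-≃ (ℚᵘP.≃-sym (toℚᵘ-components b))
  (*<* (subst (λ z → + D (suc n) m ℤ.* + suc (ℚ.denominator-1 b) ℤ.< ℚ.numerator b ℤ.* + z) (sym (D-suc-pred m n)) h))))

cross-below : ∀ m n A d → A * D n m < suc d * D (suc n) m → + A ℤ.* + D n m ℤ.< + D (suc n) m ℤ.* + suc d
cross-below m n A d h = subst₂ ℤ._<_ (ℤP.pos-* A (D n m)) (ℤP.pos-* (D (suc n) m) (suc d))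
  (ℤ.+<+ (subst (A * D n m <_) (*-comm (suc d) (D (suc n) m)) h))

cross-above : ∀ m n A d → suc d * D (suc n) m < A * D n m → + D (suc n) m ℤ.* + suc d ℤ.< + A ℤ.* + D n m
cross-above m n A d h = subst₂ ℤ._<_ (ℤP.pos-* (D (suc n) m) (suc d)) (ℤP.pos-* A (D n m))
  (ℤ.+<+ (subst (_< A * D n m) (*-comm (suc d) (D (suc n) m)) h))

eventually-above : ∀ t a → BelowTarget (suc t) a → ∃[ N ] (∀ n → N ≤ n → a ℚ.< ratio (suc t) n)
eventually-above t a@(mkℚ (+ A) d _) below =
  proj₁ bound , λ n N≤n → below-ratio (suc t) n a (cross-below (suc t) n A d (proj₂ bound n N≤n))
  where
  bound : ∃[ N ] (∀ n → N ≤ n → A * D n (suc t) < suc d * D (suc n) (suc t))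
  bound = lower-from-cut t A (suc d) (s≤s z≤n) (below-cut (lucas (suc t)) (fib (suc t)) A d (below-target-ℤ (suc t) a below))
eventually-above t a@(mkℚ -[1+ k ] d _) below =
  0 , λ n _ → below-ratio (suc t) n a (subst₂ (λ x y → -[1+ k ] ℤ.* + x ℤ.< y)
    (D-suc-pred (suc t) n) (ℤP.pos-* (D (suc n) (suc t)) (suc d)) ℤ.-<+)

eventually-below : ∀ t b → AboveTarget (suc t) b → ∃[ N ] (∀ n → N ≤ n → ratio (suc t) n ℚ.< b)
eventually-below t b@(mkℚ p d _) above =
  proj₁ bound , λ n N≤n → above-ratio (suc t) n b (subst (λ z → + D (suc n) (suc t) ℤ.* + suc d ℤ.< z ℤ.* + D n (suc t))
    (sym p≡A) (cross-above (suc t) n A d (proj₂ bound n N≤n)))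
  where
  cut : Σ ℕ λ A → p ≡ + A × AboveCut (lucas (suc t)) (fib (suc t)) A (suc d)
  cut = above-cut (lucas (suc t)) (fib (suc t)) p d (above-target-ℤ (suc t) b above)
  A : ℕ
  A = proj₁ cut
  p≡A : p ≡ + A
  p≡A = proj₁ (proj₂ cut)
  bound : ∃[ N ] (∀ n → N ≤ n → suc d * D (suc n) (suc t) < A * D n (suc t))
  bound = upper-from-cut t A (suc d) (s≤s z≤n) (proj₂ (proj₂ cut))

proposition1 : (m : ℕ) → 1 ≤ m →
    (a b : ℚ) → BelowTarget m a → AboveTarget m b →
    ∃[ N ] ((n : ℕ) → N ≤ n → (a ℚ.< ratio m n) × (ratio m n ℚ.< b))
proposition1 (suc t) _ a b below above =
  N₁ + N₂ , λ n N≤n → a<ratio n (≤-trans (m≤m+n N₁ N₂) N≤n) , ratio<b n (≤-trans (m≤n+m N₂ N₁) N≤n)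
  where
  lower : ∃[ N ] (∀ n → N ≤ n → a ℚ.< ratio (suc t) n)
  lower = eventually-above t a below
  upper : ∃[ N ] (∀ n → N ≤ n → ratio (suc t) n ℚ.< b)
  upper = eventually-below t b above
  N₁ N₂ : ℕ
  N₁ = proj₁ lower
  N₂ = proj₁ upper
  a<ratio : ∀ n → N₁ ≤ n → a ℚ.< ratio (suc t) n
  a<ratio = proj₂ lower
  ratio<b : ∀ n → N₂ ≤ n → ratio (suc t) n ℚ.< b
  ratio<b = proj₂ upper
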